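{- Let $\varphi$ be a 3-SAT formula, let $I_\varphi=(G,\omega,\mathcal P,\prec)$ with $G=(V,E)$ be the HCPP(c) instance constructed from $\varphi$ as described in the context, and let $T$ be a tight tour for $I_\varphi$. Let $M=E(T)\setminus E$ be the multiset of edges that $T$ traverses in addition to $E$ (with multiplicities, i.e. an edge traversed $r$ times appears $r-1$ times in $M$). Then: (i) $M\subseteq E_0$ and $M$ is a perfect matching on the vertex set $V_{FT}\cup V_C$; in particular $M$ contains each edge at most once; (ii) each edge in $M$ has an endpoint in $V_{FT}$; (iii) the graph with edge set $(E\setminus E_0)\cup M$ (and vertex set the endpoints of these edges) is connected.
   Context: HCPP: given an undirected graph $G=(V,E)$, weights $\omega\colon E\to\mathbb N$, a partition $\mathcal P$ of $E$ into classes and a partial order $\prec$ on $\mathcal P$, a feasible solution is a closed walk traversing every edge at least once such that each edge $e$ in a class $E'$ is traversed only after all edges in all classes $E''\prec E'$ are traversed; its weight is the sum of weights of traversed edges counted with multiplicity. A vertex is imbalanced if it has odd degree. A tight tour is a feasible solution of weight at most $|E|+b/2$, where $b$ is the number of imbalanced vertices of $G$. Construction of $I_\varphi$: $\varphi$ is in conjunctive normal form with each clause containing at most three literals. First delete every clause containing both a literal $x$ and $\bar x$. Let $x_1,\dots,x_n$ be the variables and $C_1,\dots,C_m$ the remaining clauses; for each $i$, let $\mu_i$ be the number of clauses containing $x_i$ or $\bar x_i$. All edges have weight one. $G$ contains: a path $(c_j^1,c^*,c_j^2)$ for each $j\in\{1,\dots,m\}$; for each $i\in\{1,\dots,n\}$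 and $\ell\in\{1,\dots,6\mu_i\}$ a path $P_i^\ell=(t_i^\ell,z_i^\ell,f_i^\ell)$; for each $i$ a cycle $X_i=(t_i^1,t_i^2,\dots,t_i^{6\mu_i},f_i^{6\mu_i},f_i^{6\mu_i-1},\dots,f_i^1,t_i^1)$; for each $i$ and $i'=i\bmod n+1$ a cycle $Y_{ii'}=(t_i^{6\mu_i},f_{i'}^1,f_i^{6\mu_i},t_{i'}^1,t_i^{6\mu_i})$; for each literal $x_i$ in a clause $C_j$ a cycle $Z_{ij}=(t_i^{6\ell-3},c_j^1,a_{ij},c_j^2,t_i^{6\ell-2},b_{ij},t_i^{6\ell-3})$, and for each literal $\bar x_i$ in a clause $C_j$ a cycle $\bar Z_{ij}=(f_i^{6\ell-3},c_j^1,a_{ij},c_j^2,f_i^{6\ell-2},b_{ij},f_i^{6\ell-3})$, where in both cases $\ell\le\mu_i$ is such that $C_j$ is the $\ell$-th clause containing $x_i$ or $\bar x_i$ ($a_{ij},b_{ij}$ are new vertices). The classes are: $E_i^\ell=E(P_i^\ell)$ for each $i,\ell$, ordered lexicographically by $(i,\ell)$; the class $E_0$ consisting of all edges of all cycles $X_i$, $Y_{i,i\bmod n+1}$, $Z_{ij}$ and $\bar Z_{ij}$, which precedes all classes $E_i^\ell$; and the class $E^*$ of all edges incident to $c^*$, incomparable to all other classes. $V_{FT}=\{t_i^\ell,f_i^\ell : 1\le i\le n,\ 1\le\ell\le 6\mu_i\}$ and $V_C=\{c_j^1,c_j^2: 1\le j\le m\}$. -}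

module Defs where

open import Data.Nat using (ℕ; zero; suc; _+_; _*_; _∸_; _≤_; _<_; _≡ᵇ_; _/_; _%_)
import Data.Nat.Properties as ℕP
open import Data.Bool using (Bool; true; false; if_then_else_; _∧_; _∨_; not; _xor_)
open import Data.List using (List; []; _∷_; _++_; map; concatMap; filterᵇ; length; reverse; take; upTo; zip)
open import Data.Nat.ListAction using (sum)
open import Data.Bool.ListAction using (any)
open import Data.List.Membership.Propositional using (_∈_)
open import Data.List.Relation.Unary.Unique.Propositional using (Unique)
open import Data.List.Relation.Unary.All using (All)
open import Data.Product using (Σ; ∃; ∃₂; _×_; _,_; proj₁; proj₂)
open import Data.Sum using (_⊎_)
open import Relation.Binary.PropositionalEquality using (_≡_; refl)
open import Relation.Nullary using (Dec; yes; no; ¬_)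
open import Relation.Nullary.Decidable using (⌊_⌋)
open import Relation.Binary.Construct.Closure.ReflexiveTransitive using (Star)

-- A literal is (i , s): variable x_i (i ≥ 1),
-- positive if s = true (x_i), negative if s = false (x̄_i).
-- A clause is a list of literals (read as a set: no repetitions,
-- at most three literals).

Lit : Set
Lit = ℕ × Bool

Clause : Set
Clause = List Lit

record Formula : Set where
  field
    nvars   : ℕ
    clauses : List Clause
open Formula public

-- Vertices of G (1-based indices as in the paper)

data Vtx : Set where
  vc¹ vc² : ℕ → Vtx
  vc*     : Vtx
  vt vz vf : ℕ → ℕ → Vtx
  va vb   : ℕ → ℕ → Vtx

private
  dec1 : ∀ {C : ℕ → Vtx} → (∀ {x y} → C x ≡ C y → x ≡ y) → (x y : ℕ) → Dec (C x ≡ C y)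
  dec1 inj x y with x ℕP.≟ y
  ... | yes refl = yes refl
  ... | no ne = no λ e → ne (inj e)

  dec2 : ∀ {C : ℕ → ℕ → Vtx} → (∀ {x y x' y'} → C x y ≡ C x' y' → (x ≡ x') × (y ≡ y')) →
         (x y x' y' : ℕ) → Dec (C x y ≡ C x' y')
  dec2 inj x y x' y' with x ℕP.≟ x' | y ℕP.≟ y'
  ... | yes refl | yes refl = yes refl
  ... | no ne | _ = no λ e → ne (proj₁ (inj e))
  ... | _ | no ne = no λ e → ne (proj₂ (inj e))

_≟V_ : (u v : Vtx) → Dec (u ≡ v)
vc¹ x ≟V vc¹ y = dec1 (λ { refl → refl }) x y
vc² x ≟V vc² y = dec1 (λ { refl → refl }) x y
vc* ≟V vc* = yes refl
vt x y ≟V vt x' y' = dec2 (λ { refl → refl , refl }) x y x' y'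
vz x y ≟V vz x' y' = dec2 (λ { refl → refl , refl }) x y x' y'
vf x y ≟V vf x' y' = dec2 (λ { refl → refl , refl }) x y x' y'
va x y ≟V va x' y' = dec2 (λ { refl → refl , refl }) x y x' y'
vb x y ≟V vb x' y' = dec2 (λ { refl → refl , refl }) x y x' y'
vc¹ _ ≟V vc² _ = no λ ()
vc¹ _ ≟V vc* = no λ ()
vc¹ _ ≟V vt _ _ = no λ ()
vc¹ _ ≟V vz _ _ = no λ ()
vc¹ _ ≟V vf _ _ = no λ ()
vc¹ _ ≟V va _ _ = no λ ()
vc¹ _ ≟V vb _ _ = no λ ()
vc² _ ≟V vc¹ _ = no λ ()
vc² _ ≟V vc* = no λ ()
vc² _ ≟V vt _ _ = no λ ()
vc² _ ≟V vz _ _ = no λ ()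
vc² _ ≟V vf _ _ = no λ ()
vc² _ ≟V va _ _ = no λ ()
vc² _ ≟V vb _ _ = no λ ()
vc* ≟V vc¹ _ = no λ ()
vc* ≟V vc² _ = no λ ()
vc* ≟V vt _ _ = no λ ()
vc* ≟V vz _ _ = no λ ()
vc* ≟V vf _ _ = no λ ()
vc* ≟V va _ _ = no λ ()
vc* ≟V vb _ _ = no λ ()
vt _ _ ≟V vc¹ _ = no λ ()
vt _ _ ≟V vc² _ = no λ ()
vt _ _ ≟V vc* = no λ ()
vt _ _ ≟V vz _ _ = no λ ()
vt _ _ ≟V vf _ _ = no λ ()
vt _ _ ≟V va _ _ = no λ ()
vt _ _ ≟V vb _ _ = no λ ()
vz _ _ ≟V vc¹ _ = no λ ()
vz _ _ ≟V vc² _ = no λ ()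
vz _ _ ≟V vc* = no λ ()
vz _ _ ≟V vt _ _ = no λ ()
vz _ _ ≟V vf _ _ = no λ ()
vz _ _ ≟V va _ _ = no λ ()
vz _ _ ≟V vb _ _ = no λ ()
vf _ _ ≟V vc¹ _ = no λ ()
vf _ _ ≟V vc² _ = no λ ()
vf _ _ ≟V vc* = no λ ()
vf _ _ ≟V vt _ _ = no λ ()
vf _ _ ≟V vz _ _ = no λ ()
vf _ _ ≟V va _ _ = no λ ()
vf _ _ ≟V vb _ _ = no λ ()
va _ _ ≟V vc¹ _ = no λ ()
va _ _ ≟V vc² _ = no λ ()
va _ _ ≟V vc* = no λ ()
va _ _ ≟V vt _ _ = no λ ()
va _ _ ≟V vz _ _ = no λ ()
va _ _ ≟V vf _ _ = no λ ()
va _ _ ≟V vb _ _ = no λ ()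
vb _ _ ≟V vc¹ _ = no λ ()
vb _ _ ≟V vc² _ = no λ ()
vb _ _ ≟V vc* = no λ ()
vb _ _ ≟V vt _ _ = no λ ()
vb _ _ ≟V vz _ _ = no λ ()
vb _ _ ≟V vf _ _ = no λ ()
vb _ _ ≟V va _ _ = no λ ()

_==V_ : Vtx → Vtx → Bool
u ==V v = ⌊ u ≟V v ⌋

-- An edge {u,v} is stored as a pair (u , v); the graph G is simple,
-- so an edge is determined by its endpoints.
Edge : Set
Edge = Vtx × Vtx

StepOn : Vtx → Vtx → Edge → Set
StepOn u v e = ((u , v) ≡ e) ⊎ ((v , u) ≡ e)

stepOnᵇ : Vtx → Vtx → Edge → Bool
stepOnᵇ u v (x , y) = ((u ==V x) ∧ (v ==V y)) ∨ ((u ==V y) ∧ (v ==V x))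

pathEdges : List Vtx → List Edge
pathEdges (u ∷ v ∷ rest) = (u , v) ∷ pathEdges (v ∷ rest)
pathEdges _ = []

one-to : ℕ → List ℕ
one-to k = map suc (upTo k)

-- pairs (j , x_j) with 1-based index j
indexed : {A : Set} → List A → List (ℕ × A)
indexed xs = zip (one-to (length xs)) xs

-- Closed walks: vertex sequence vtx 0, vtx 1, …, vtx len with
-- vtx len = vtx 0; step k (k < len) goes from vtx k to vtx (suc k).
-- (Values of vtx beyond len are irrelevant.)

record ClosedWalk : Set where
  field
    len    : ℕ
    vtx    : ℕ → Vtx
    closed : vtx len ≡ vtx 0
open ClosedWalk public

Trav : ClosedWalk → ℕ → Edge → Set
Trav W k e = StepOn (vtx W k) (vtx W (suc k)) e

mult : ClosedWalk → Edge → ℕ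
mult W e = length (filterᵇ (λ k → stepOnᵇ (vtx W k) (vtx W (suc k)) e) (upTo (len W)))

module Construction (φ : Formula) where

  n : ℕ
  n = nvars φ

  tautological : Clause → Bool
  tautological C = any (λ l → any (λ l' → (proj₁ l ≡ᵇ proj₁ l') ∧ (proj₂ l xor proj₂ l')) C) C

  rem : List Clause
  rem = filterᵇ (λ C → not (tautological C)) (clauses φ)

  m : ℕ
  m = length rem

  mentions : ℕ → Clause → Bool
  mentions i C = any (λ l → proj₁ l ≡ᵇ i) C

  μ : ℕ → ℕ
  μ i = length (filterᵇ (mentions i) rem)

  -- ℓ such that C_j is the ℓ-th clause containing x_i or x̄_i
  pos : ℕ → ℕ → ℕ
  pos i j = suc (length (filterᵇ (mentions i) (take (j ∸ 1) rem)))

  nxt : ℕ → ℕ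
  nxt i = if i ≡ᵇ n then 1 else suc i

  Xedges : ℕ → List Edge
  Xedges i = pathEdges (map (vt i) (one-to (6 * μ i)) ++ map (vf i) (reverse (one-to (6 * μ i))) ++ vt i 1 ∷ [])

  Yedges : ℕ → List Edge
  Yedges i = pathEdges (vt i (6 * μ i) ∷ vf (nxt i) 1 ∷ vf i (6 * μ i) ∷ vt (nxt i) 1 ∷ vt i (6 * μ i) ∷ [])

  Zedges : ℕ → Lit → List Edge
  Zedges j (i , s) =
    let ℓ = pos i j
        u = if s then vt else vf
    in pathEdges (u i (6 * ℓ ∸ 3) ∷ vc¹ j ∷ va i j ∷ vc² j ∷ u i (6 * ℓ ∸ 2) ∷ vb i j ∷ u i (6 * ℓ ∸ 3) ∷ [])

  E₀ : List Edge
  E₀ = concatMap (λ i → Xedges i ++ Yedges i) (one-to n)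
       ++ concatMap (λ jC → concatMap (Zedges (proj₁ jC)) (proj₂ jC)) (indexed rem)

  Pedges : ℕ → ℕ → List Edge
  Pedges i ℓ = (vt i ℓ , vz i ℓ) ∷ (vz i ℓ , vf i ℓ) ∷ []

  EP : List Edge
  EP = concatMap (λ i → concatMap (Pedges i) (one-to (6 * μ i))) (one-to n)

  E* : List Edge
  E* = concatMap (λ j → (vc¹ j , vc*) ∷ (vc* , vc² j) ∷ []) (one-to m)

  E : List Edge
  E = E₀ ++ EP ++ E*

  V : List Vtx
  V = vc* ∷ concatMap (λ j → vc¹ j ∷ vc² j ∷ []) (one-to m)
      ++ concatMap (λ i → concatMap (λ ℓ → vt i ℓ ∷ vz i ℓ ∷ vf i ℓ ∷ []) (one-to (6 * μ i))) (one-to n)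
      ++ concatMap (λ jC → concatMap (λ l → va (proj₁ l) (proj₁ jC) ∷ vb (proj₁ l) (proj₁ jC) ∷ []) (proj₂ jC)) (indexed rem)

  deg : Vtx → ℕ
  deg v = sum (map (λ e → (if v ==V proj₁ e then 1 else 0) + (if v ==V proj₂ e then 1 else 0)) E)

  imb : ℕ
  imb = length (filterᵇ (λ v → deg v % 2 ≡ᵇ 1) V)

  data Class : Set where
    cE₀   : Class
    cP    : ℕ → ℕ → Class
    cStar : Class

  _∈C_ : Edge → Class → Set
  e ∈C cE₀ = e ∈ E₀
  e ∈C cP i ℓ = (1 ≤ i) × (i ≤ n) × (1 ≤ ℓ) × (ℓ ≤ 6 * μ i) × (e ∈ Pedges i ℓ)
  e ∈C cStar = e ∈ E*

  data _≺_ : Class → Class → Set where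
    E₀≺P : ∀ {i ℓ} → cE₀ ≺ cP i ℓ
    P≺P₁ : ∀ {i ℓ i' ℓ'} → i < i' → cP i ℓ ≺ cP i' ℓ'
    P≺P₂ : ∀ {i ℓ ℓ'} → ℓ < ℓ' → cP i ℓ ≺ cP i ℓ'

  record Feasible (W : ClosedWalk) : Set where
    field
      onEdges  : ∀ k → k < len W → ∃ λ e → (e ∈ E) × Trav W k e
      covers   : ∀ e → e ∈ E → ∃ λ k → (k < len W) × Trav W k e
      respects : ∀ K K' → K' ≺ K → ∀ k → k < len W → ∀ e → e ∈C K → Trav W k e →
                 ∀ e' → e' ∈C K' → ∃ λ k' → (k' < k) × Trav W k' e'

  -- weight (all edge weights are one) = number of traversals
  weight : ClosedWalk → ℕ
  weight W = len W

  TightTour : ClosedWalk → Set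
  TightTour W = Feasible W × (weight W ≤ length E + imb / 2)

  V-FT : Vtx → Set
  V-FT v = ∃₂ λ i ℓ → (1 ≤ i) × (i ≤ n) × (1 ≤ ℓ) × (ℓ ≤ 6 * μ i) × ((v ≡ vt i ℓ) ⊎ (v ≡ vf i ℓ))

  V-C : Vtx → Set
  V-C v = ∃ λ j → (1 ≤ j) × (j ≤ m) × ((v ≡ vc¹ j) ⊎ (v ≡ vc² j))

  Mmult : ClosedWalk → Edge → ℕ
  Mmult W e = mult W e ∸ 1

  InM : ClosedWalk → Edge → Set
  InM W e = (e ∈ E) × (1 ≤ Mmult W e)

  incident : Vtx → Edge → Bool
  incident v e = (v ==V proj₁ e) ∨ (v ==V proj₂ e)

  Conclusion-i : ClosedWalk → Set
  Conclusion-i W =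
      (∀ e → InM W e → e ∈ E₀)
    × (∀ e → InM W e → (V-FT (proj₁ e) ⊎ V-C (proj₁ e)) × (V-FT (proj₂ e) ⊎ V-C (proj₂ e)))
    × (∀ v → V-FT v ⊎ V-C v → sum (map (λ e → if incident v e then Mmult W e else 0) E) ≡ 1)
    × (∀ e → e ∈ E → Mmult W e ≤ 1)

  Conclusion-ii : ClosedWalk → Set
  Conclusion-ii W = ∀ e → InM W e → V-FT (proj₁ e) ⊎ V-FT (proj₂ e)

  HEdge : ClosedWalk → Edge → Set
  HEdge W e = ((e ∈ E) × ¬ (e ∈ E₀)) ⊎ InM W e

  HAdj : ClosedWalk → Vtx → Vtx → Set
  HAdj W u v = ∃ λ e → HEdge W e × StepOn u v e

  HVtx : ClosedWalk → Vtx → Set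
  HVtx W v = ∃ λ e → HEdge W e × ((proj₁ e ≡ v) ⊎ (proj₂ e ≡ v))

  Conclusion-iii : ClosedWalk → Set
  Conclusion-iii W = ∀ u v → HVtx W u → HVtx W v → Star (HAdj W) u v

  -- φ is a 3-CNF formula over x_1 … x_n, and x_1 … x_n are exactly the
  -- variables of the formula after deleting tautological clauses
  WellFormed : Set
  WellFormed =
      All (λ C → (length C ≤ 3) × Unique C × All (λ l → (1 ≤ proj₁ l) × (proj₁ l ≤ n)) C) (clauses φ)
    × (∀ i → 1 ≤ i → i ≤ n → 1 ≤ μ i)

open Construction public using (WellFormed; TightTour; Conclusion-i; Conclusion-ii; Conclusion-iii)

{-# OPTIONS --safe #-}
module Submission where

-- A tight tour traverses |E| edges plus the multiset M, so |M| ≤ b/2.  Each visit of the tour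
-- to a vertex uses two edge-ends there, so the number of M-edges at v has the parity of deg v:
-- every odd vertex meets M, and since M has at most b/2 edges, each odd vertex meets exactly
-- one edge of M, each even vertex none, and no edge is traversed three times.  The odd vertices are
-- exactly V_FT ∪ V_C, because E₀ is a union of cycles and each t, f, c vertex lies on exactly
-- one edge outside E₀; no edge joins two vertices of V_C, so M-edges meet V_FT.  Finally E₀
-- precedes every path class, so after the first traversal of a path edge each step of the tour
-- either leaves E₀ or repeats an edge of E₀, i.e. lies in H; following the tour to its end
-- joins every vertex of H to the starting vertex.

open import Defs
open import Data.Bool using (Bool; true; false; if_then_else_; _∧_; _∨_; not; _xor_; T; T?)
open import Data.Bool.ListAction using (any)
open import Data.Bool.Properties using (∨-comm; ∨-zeroʳ; T-≡)
open import Data.Empty using (⊥; ⊥-elim)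
open import Data.List using (List; []; _∷_; _++_; map; concatMap; filterᵇ; length; upTo; reverse; zip; take)
open import Data.List.Membership.Propositional using (_∈_; find; lose)
open import Data.List.Membership.Propositional.Properties
  using (∈-map⁻; ∈-map⁺; ∈-upTo⁻; ∈-upTo⁺; ∈-++⁻; ∈-++⁺ˡ; ∈-++⁺ʳ; ∈-concatMap⁺; ∈-concatMap⁻; ∈-filter⁻)
open import Data.List.Properties
  using (map-++; map-∘; map-id; map-upTo; upTo-∷ʳ; reverse-++; length-upTo; length-++; filter-++)
open import Data.List.Relation.Unary.All using (All; []; _∷_)
import Data.List.Relation.Unary.All as All
import Data.List.Relation.Unary.All.Properties as All
open import Data.List.Relation.Unary.AllPairs using (AllPairs; []; _∷_)
import Data.List.Relation.Unary.AllPairs as AllPairs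
import Data.List.Relation.Unary.AllPairs.Properties as AllPairs
open import Data.List.Relation.Unary.Any using (here; there)
open import Data.List.Relation.Unary.Any.Properties using (any⁺)
open import Data.Nat using (ℕ; zero; suc; _+_; _*_; _∸_; _≤_; _<_; z≤n; s≤s; _≡ᵇ_; _/_; _%_; _⊔_)
open import Data.Nat.DivMod using (m*n%n≡0; m/n*n≤m; [m+kn]%n≡m%n)
open import Data.Nat.Divisibility using (_∣_; divides; ∣m∣n⇒∣m+n)
open import Data.Nat.ListAction using (sum)
open import Data.Nat.ListAction.Properties using (sum-++)
import Data.Nat.Properties as ℕ
open import Data.Nat.Tactic.RingSolver using (solve-∀)
open import Data.Product using (∃; ∃₂; _×_; _,_; proj₁; proj₂; swap; map₂)
open import Data.Product.Properties using (≡-dec)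
open import Data.List.Membership.DecPropositional (≡-dec _≟V_ _≟V_) using (_∈?_)
open import Data.Sum using (_⊎_; inj₁; inj₂; [_,_]) renaming (swap to ⊎-swap)
open import Data.Unit using (tt)
open import Function using (_∘_; Equivalence)
open import Relation.Binary.Construct.Closure.ReflexiveTransitive using (Star; ε; _◅_; _◅◅_)
import Relation.Binary.Construct.Closure.ReflexiveTransitive as Star
open import Relation.Binary.PropositionalEquality
  using (_≡_; _≢_; refl; sym; trans; cong; cong₂; subst; module ≡-Reasoning)
open import Relation.Nullary using (¬_; Dec; yes; no)

-- Agrees definitionally with the `if _ then 1 else 0` used for degrees in Defs, unlike `Data.Bool.toℕ`.
χ : Bool → ℕ
χ b = if b then 1 else 0

χ≤1 : ∀ b → χ b ≤ 1
χ≤1 true = ℕ.≤-refl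
χ≤1 false = z≤n

χ-pos⁻ : ∀ {b} → 1 ≤ χ b → b ≡ true
χ-pos⁻ {true} _ = refl

n+n≡n*2 : ∀ n → n + n ≡ n * 2
n+n≡n*2 = solve-∀

∑ : {A : Set} → List A → (A → ℕ) → ℕ
∑ xs f = sum (map f xs)

module _ {A : Set} where

  ∑-++ : (xs ys : List A) (f : A → ℕ) → ∑ (xs ++ ys) f ≡ ∑ xs f + ∑ ys f
  ∑-++ xs ys f = trans (cong sum (map-++ f xs ys)) (sum-++ (map f xs) (map f ys))

  ∑-cong : (xs : List A) {f g : A → ℕ} → (∀ x → f x ≡ g x) → ∑ xs f ≡ ∑ xs g
  ∑-cong [] h = refl
  ∑-cong (x ∷ xs) h = cong₂ _+_ (h x) (∑-cong xs h)

  ∑-congᴬ : {xs : List A} {f g : A → ℕ} → All (λ x → f x ≡ g x) xs → ∑ xs f ≡ ∑ xs g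
  ∑-congᴬ [] = refl
  ∑-congᴬ (p ∷ ps) = cong₂ _+_ p (∑-congᴬ ps)

  ∑-monoᴬ : {xs : List A} {f g : A → ℕ} → All (λ x → f x ≤ g x) xs → ∑ xs f ≤ ∑ xs g
  ∑-monoᴬ [] = z≤n
  ∑-monoᴬ (p ∷ ps) = ℕ.+-mono-≤ p (∑-monoᴬ ps)

  ∑-zero : {xs : List A} {f : A → ℕ} → All (λ x → f x ≡ 0) xs → ∑ xs f ≡ 0
  ∑-zero [] = refl
  ∑-zero (p ∷ ps) = cong₂ _+_ p (∑-zero ps)

  ∑-+ : (xs : List A) (f g : A → ℕ) → ∑ xs (λ x → f x + g x) ≡ ∑ xs f + ∑ xs g
  ∑-+ [] f g = refl
  ∑-+ (x ∷ xs) f g = trans (cong (f x + g x +_) (∑-+ xs f g)) (interchange (f x) (g x) (∑ xs f) (∑ xs g))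
    where
    interchange : ∀ a b c d → a + b + (c + d) ≡ a + c + (b + d)
    interchange = solve-∀

  ∑-* : (xs : List A) (c : ℕ) (f : A → ℕ) → ∑ xs (λ x → c * f x) ≡ c * ∑ xs f
  ∑-* [] c f = sym (ℕ.*-zeroʳ c)
  ∑-* (x ∷ xs) c f = trans (cong (c * f x +_) (∑-* xs c f)) (sym (ℕ.*-distribˡ-+ c (f x) (∑ xs f)))

  ∑-const-1 : (xs : List A) → ∑ xs (λ _ → 1) ≡ length xs
  ∑-const-1 [] = refl
  ∑-const-1 (x ∷ xs) = cong suc (∑-const-1 xs)

  term≤∑ : {xs : List A} (f : A → ℕ) {x : A} → x ∈ xs → f x ≤ ∑ xs f
  term≤∑ {y ∷ ys} f (here refl) = ℕ.m≤m+n (f y) _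
  term≤∑ {y ∷ ys} f (there p) = ℕ.≤-trans (term≤∑ f p) (ℕ.m≤n+m _ (f y))

  two-terms≤∑ : {xs : List A} (f : A → ℕ) {x y : A} → AllPairs _≢_ xs → x ∈ xs → y ∈ xs → x ≢ y →
                f x + f y ≤ ∑ xs f
  two-terms≤∑ f (_ ∷ _) (here refl) (here refl) x≢y = ⊥-elim (x≢y refl)
  two-terms≤∑ f (_ ∷ _) (here refl) (there y∈) _ = ℕ.+-monoʳ-≤ (f _) (term≤∑ f y∈)
  two-terms≤∑ {z ∷ zs} f {x} {y} (_ ∷ _) (there x∈) (here refl) _ =
    subst (_≤ f z + ∑ zs f) (ℕ.+-comm (f y) (f x)) (ℕ.+-monoʳ-≤ (f z) (term≤∑ f x∈))
  two-terms≤∑ {z ∷ zs} f (_ ∷ ps) (there x∈) (there y∈) x≢y =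
    ℕ.≤-trans (two-terms≤∑ f ps x∈ y∈ x≢y) (ℕ.m≤n+m _ (f z))

  positive-term : {xs : List A} (f : A → ℕ) → 1 ≤ ∑ xs f → ∃ λ x → (x ∈ xs) × (1 ≤ f x)
  positive-term {x ∷ xs} f 1≤∑ with f x in fx≡
  ... | suc _ = x , here refl , subst (1 ≤_) (sym fx≡) (s≤s z≤n)
  ... | zero with positive-term {xs} f 1≤∑
  ...   | y , y∈ , 1≤fy = y , there y∈ , 1≤fy

  ∑-squeeze : {xs : List A} {f g : A → ℕ} → All (λ x → g x ≤ f x) xs → ∑ xs f ≤ ∑ xs g →
              All (λ x → f x ≡ g x) xs
  ∑-squeeze [] _ = []
  ∑-squeeze {x ∷ xs} {f} {g} (gx≤fx ∷ g≤f) ∑f≤∑g = fx≡gx ∷ ∑-squeeze g≤f ∑f≤∑g′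
    where
    fx≡gx : f x ≡ g x
    fx≡gx = ℕ.≤-antisym
      (ℕ.+-cancelʳ-≤ (∑ xs f) (f x) (g x) (ℕ.≤-trans ∑f≤∑g (ℕ.+-monoʳ-≤ (g x) (∑-monoᴬ g≤f)))) gx≤fx
    ∑f≤∑g′ : ∑ xs f ≤ ∑ xs g
    ∑f≤∑g′ = ℕ.+-cancelˡ-≤ (f x) (∑ xs f) (∑ xs g) (subst (λ z → f x + ∑ xs f ≤ z + ∑ xs g) (sym fx≡gx) ∑f≤∑g)

  ∑≤1 : {R : A → A → Set} {xs : List A} (f : A → ℕ) → AllPairs R xs → (∀ x → f x ≤ 1) →
        (∀ {x y} → 1 ≤ f x → 1 ≤ f y → ¬ R x y) → ∑ xs f ≤ 1
  ∑≤1 f [] _ _ = z≤n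
  ∑≤1 {R = R} {xs = x ∷ xs} f (Rx ∷ Rxs) f≤1 clash with f x in fx≡
  ... | zero = ∑≤1 f Rxs f≤1 clash
  ... | suc k = subst (λ z → suc k + z ≤ 1) (sym rest≡0)
                  (subst (_≤ 1) (sym (ℕ.+-identityʳ (suc k))) (subst (_≤ 1) fx≡ (f≤1 x)))
    where
    vanishes : ∀ y → R x y → f y ≡ 0
    vanishes y r with f y in fy≡
    ... | zero = refl
    ... | suc _ = ⊥-elim (clash (subst (1 ≤_) (sym fx≡) (s≤s z≤n)) (subst (1 ≤_) (sym fy≡) (s≤s z≤n)) r)
    rest≡0 : ∑ xs f ≡ 0
    rest≡0 = ∑-zero (All.map (λ {y} → vanishes y) Rx)

  ∑-single : {xs : List A} (f : A → ℕ) {a : A} → AllPairs _≢_ xs → a ∈ xs →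
             (∀ x → x ≢ a → f x ≡ 0) → ∑ xs f ≡ f a
  ∑-single f (a≢ ∷ _) (here refl) others =
    trans (cong (f _ +_) (∑-zero (All.map (λ ne → others _ (λ e → ne (sym e))) a≢))) (ℕ.+-identityʳ _)
  ∑-single {x ∷ xs} f (x≢ ∷ ps) (there a∈) others =
    trans (cong (_+ ∑ xs f) (others x (All.lookup x≢ a∈))) (∑-single f ps a∈ others)

∑-concatMap : {A B : Set} (g : A → List B) (xs : List A) (f : B → ℕ) →
              ∑ (concatMap g xs) f ≡ ∑ xs (λ x → ∑ (g x) f)
∑-concatMap g [] f = refl
∑-concatMap g (x ∷ xs) f = trans (∑-++ (g x) (concatMap g xs) f) (cong (∑ (g x) f +_) (∑-concatMap g xs f))

∑-comm : {A B : Set} (xs : List A) (ys : List B) (F : A → B → ℕ) →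
         ∑ xs (λ x → ∑ ys (F x)) ≡ ∑ ys (λ y → ∑ xs (λ x → F x y))
∑-comm [] ys F = sym (∑-zero {xs = ys} (All.tabulate (λ _ → refl)))
∑-comm (x ∷ xs) ys F = trans (cong (∑ ys (F x) +_) (∑-comm xs ys F)) (sym (∑-+ ys (F x) (λ y → ∑ xs (λ x′ → F x′ y))))

length-filterᵇ : {A : Set} (p : A → Bool) (xs : List A) → length (filterᵇ p xs) ≡ ∑ xs (λ x → χ (p x))
length-filterᵇ p [] = refl
length-filterᵇ p (x ∷ xs) with p x
... | true = cong suc (length-filterᵇ p xs)
... | false = length-filterᵇ p xs

∑-upTo-rotate : (n : ℕ) (g : ℕ → ℕ) → g n ≡ g 0 → ∑ (upTo n) (λ k → g (suc k)) ≡ ∑ (upTo n) g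
∑-upTo-rotate n g gn≡g0 = ℕ.+-cancelˡ-≡ (g 0) _ _ (begin
    g 0 + ∑ (upTo n) (λ k → g (suc k))   ≡⟨ cong (λ l → g 0 + sum l) (trans (cong (map g) (sym (map-upTo suc n))) (sym (map-∘ (upTo n)))) ⟨
    ∑ (upTo (suc n)) g                   ≡⟨ cong (λ l → ∑ l g) (upTo-∷ʳ n) ⟨
    ∑ (upTo n ++ n ∷ []) g               ≡⟨ ∑-++ (upTo n) (n ∷ []) g ⟩
    ∑ (upTo n) g + (g n + 0)             ≡⟨ cong (λ z → ∑ (upTo n) g + z) (trans (ℕ.+-identityʳ (g n)) gn≡g0) ⟩
    ∑ (upTo n) g + g 0                   ≡⟨ ℕ.+-comm (∑ (upTo n) g) (g 0) ⟩
    g 0 + ∑ (upTo n) g                   ∎)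
  where open ≡-Reasoning

==V-refl : ∀ v → (v ==V v) ≡ true
==V-refl v with v ≟V v
... | yes _ = refl
... | no v≢v = ⊥-elim (v≢v refl)

==V⇒≡ : ∀ u v → (u ==V v) ≡ true → u ≡ v
==V⇒≡ u v _ with u ≟V v
... | yes u≡v = u≡v

≢⇒==V-false : ∀ u v → u ≢ v → (u ==V v) ≡ false
≢⇒==V-false u v u≢v with u ≟V v
... | yes u≡v = ⊥-elim (u≢v u≡v)
... | no _ = refl

true≢false : ∀ {b} → b ≡ true → b ≡ false → ⊥
true≢false refl ()

∧-true⁻ : ∀ {a b} → (a ∧ b) ≡ true → (a ≡ true) × (b ≡ true)
∧-true⁻ {true} {true} _ = refl , refl

∨-true⁻ : ∀ {a b} → (a ∨ b) ≡ true → (a ≡ true) ⊎ (b ≡ true)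
∨-true⁻ {true} _ = inj₁ refl
∨-true⁻ {false} {true} _ = inj₂ refl

stepOnᵇ-sound : ∀ u v e → stepOnᵇ u v e ≡ true → StepOn u v e
stepOnᵇ-sound u v (x , y) holds with ∨-true⁻ {(u ==V x) ∧ (v ==V y)} holds
... | inj₁ forward with ∧-true⁻ forward
...   | u≡x , v≡y rewrite ==V⇒≡ u x u≡x | ==V⇒≡ v y v≡y = inj₁ refl
stepOnᵇ-sound u v (x , y) holds | inj₂ backward with ∧-true⁻ backward
...   | u≡y , v≡x rewrite ==V⇒≡ u y u≡y | ==V⇒≡ v x v≡x = inj₂ refl

stepOnᵇ-complete : ∀ u v e → StepOn u v e → stepOnᵇ u v e ≡ true
stepOnᵇ-complete u v .(u , v) (inj₁ refl) rewrite ==V-refl u | ==V-refl v = refl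
stepOnᵇ-complete u v .(v , u) (inj₂ refl) rewrite ==V-refl u | ==V-refl v with (u ==V v) ∧ (v ==V u)
... | true = refl
... | false = refl

_≈ᴱ_ : Edge → Edge → Set
e ≈ᴱ e′ = (e′ ≡ e) ⊎ (e′ ≡ swap e)

_≉ᴱ_ : Edge → Edge → Set
e ≉ᴱ e′ = ¬ (e ≈ᴱ e′)

StepOn-unique : ∀ {u v x y} → StepOn u v x → StepOn u v y → x ≈ᴱ y
StepOn-unique (inj₁ refl) (inj₁ refl) = inj₁ refl
StepOn-unique (inj₁ refl) (inj₂ refl) = inj₂ refl
StepOn-unique (inj₂ refl) (inj₁ refl) = inj₂ refl
StepOn-unique (inj₂ refl) (inj₂ refl) = inj₁ refl

incidentᵇ : Vtx → Edge → Bool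
incidentᵇ v e = (v ==V proj₁ e) ∨ (v ==V proj₂ e)

incidentᵇ-swap : ∀ v e → incidentᵇ v (swap e) ≡ incidentᵇ v e
incidentᵇ-swap v (a , b) = ∨-comm (v ==V b) (v ==V a)

endpointCount : Vtx → Edge → ℕ
endpointCount v e = χ (v ==V proj₁ e) + χ (v ==V proj₂ e)

degreeIn : List Edge → Vtx → ℕ
degreeIn E v = ∑ E (endpointCount v)

χ-incidentᵇ : ∀ v a b → a ≢ b → χ (incidentᵇ v (a , b)) ≡ endpointCount v (a , b)
χ-incidentᵇ v a b a≢b with v ==V a in v≡a | v ==V b in v≡b
... | true | true = ⊥-elim (a≢b (trans (sym (==V⇒≡ v a v≡a)) (==V⇒≡ v b v≡b)))
... | true | false = refl
... | false | true = refl
... | false | false = refl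

-- A closed walk through every edge of a simple graph

module SurplusCount (E : List Edge) (V : List Vtx) (W : ClosedWalk)
  (E-distinct : AllPairs _≉ᴱ_ E) (loopless : All (λ e → proj₁ e ≢ proj₂ e) E) (V-distinct : AllPairs _≢_ V)
  (onEdges : ∀ k → k < len W → ∃ λ e → (e ∈ E) × Trav W k e)
  (covers : ∀ e → e ∈ E → ∃ λ k → (k < len W) × Trav W k e) where

  L : ℕ
  L = len W

  usesᵇ : ℕ → Edge → Bool
  usesᵇ k e = stepOnᵇ (vtx W k) (vtx W (suc k)) e

  excess : Edge → ℕ
  excess e = mult W e ∸ 1

  surplus : Vtx → ℕ
  surplus v = sum (map (λ e → if incidentᵇ v e then excess e else 0) E)

  visits : Vtx → ℕ
  visits v = ∑ (upTo L) (λ k → χ (v ==V vtx W k))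

  isOdd : Vtx → ℕ
  isOdd v = χ (degreeIn E v % 2 ≡ᵇ 1)

  mult≡∑ : ∀ e → mult W e ≡ ∑ (upTo L) (λ k → χ (usesᵇ k e))
  mult≡∑ e = length-filterᵇ (λ k → usesᵇ k e) (upTo L)

  traversal-counted : ∀ {k e} → k < L → Trav W k e → 1 ≤ ∑ (upTo L) (λ k → χ (usesᵇ k e))
  traversal-counted {k} {e} k<L tr =
    ℕ.≤-trans (ℕ.≤-reflexive (cong χ (sym (stepOnᵇ-complete (vtx W k) (vtx W (suc k)) e tr)))) (term≤∑ (λ k → χ (usesᵇ k e)) (∈-upTo⁺ k<L))

  mult-pos : ∀ e → e ∈ E → 1 ≤ mult W e
  mult-pos e e∈E with covers e e∈E
  ... | k , k<L , tr = subst (1 ≤_) (sym (mult≡∑ e)) (traversal-counted k<L tr)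

  edges-per-step≤1 : ∀ k → ∑ E (λ e → χ (usesᵇ k e)) ≤ 1
  edges-per-step≤1 k = ∑≤1 (λ e → χ (usesᵇ k e)) E-distinct (λ e → χ≤1 (usesᵇ k e))
    (λ {x} {y} ux uy x≉y → x≉y (StepOn-unique (sound x ux) (sound y uy)))
    where
    sound : ∀ e → 1 ≤ χ (usesᵇ k e) → Trav W k e
    sound e = stepOnᵇ-sound (vtx W k) (vtx W (suc k)) e ∘ χ-pos⁻

  edges-per-step≡1 : ∀ k → k < L → ∑ E (λ e → χ (usesᵇ k e)) ≡ 1
  edges-per-step≡1 k k<L with onEdges k k<L
  ... | e , e∈E , tr = ℕ.≤-antisym (edges-per-step≤1 k)
    (ℕ.≤-trans (ℕ.≤-reflexive (cong χ (sym (stepOnᵇ-complete (vtx W k) (vtx W (suc k)) e tr)))) (term≤∑ (λ e → χ (usesᵇ k e)) e∈E))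

  step-not-loop : ∀ k → k < L → vtx W k ≢ vtx W (suc k)
  step-not-loop k k<L eq with onEdges k k<L
  ... | e , e∈E , inj₁ refl = All.lookup loopless e∈E eq
  ... | e , e∈E , inj₂ refl = All.lookup loopless e∈E (sym eq)

  ∑mult≤L : ∑ E (mult W) ≤ L
  ∑mult≤L = begin
      ∑ E (mult W)                                ≡⟨ ∑-cong E mult≡∑ ⟩
      ∑ E (λ e → ∑ (upTo L) (λ k → χ (usesᵇ k e))) ≡⟨ ∑-comm E (upTo L) (λ e k → χ (usesᵇ k e)) ⟩
      ∑ (upTo L) (λ k → ∑ E (λ e → χ (usesᵇ k e))) ≤⟨ ∑-monoᴬ {xs = upTo L} (All.tabulate (λ {k} _ → edges-per-step≤1 k)) ⟩
      ∑ (upTo L) (λ _ → 1)                        ≡⟨ ∑-const-1 (upTo L) ⟩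
      length (upTo L)                             ≡⟨ length-upTo L ⟩
      L                                           ∎
    where open ℕ.≤-Reasoning

  ∑mult≡∑excess+|E| : ∑ E (mult W) ≡ ∑ E excess + length E
  ∑mult≡∑excess+|E| = begin
      ∑ E (mult W)                  ≡⟨ ∑-congᴬ (All.tabulate (λ {e} e∈E → sym (ℕ.m∸n+n≡m (mult-pos e e∈E)))) ⟩
      ∑ E (λ e → excess e + 1)      ≡⟨ ∑-+ E excess (λ _ → 1) ⟩
      ∑ E excess + ∑ E (λ _ → 1)    ≡⟨ cong (∑ E excess +_) (∑-const-1 E) ⟩
      ∑ E excess + length E         ∎
    where open ≡-Reasoning

  endsAt : Vtx → ℕ → ℕ
  endsAt v k = χ (v ==V vtx W k)

  step-endpoints : ∀ v k → k < L → ∀ e →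
    χ (incidentᵇ v e) * χ (usesᵇ k e) ≡ (endsAt v k + endsAt v (suc k)) * χ (usesᵇ k e)
  step-endpoints v k k<L e with usesᵇ k e in uses
  ... | false = trans (ℕ.*-zeroʳ (χ (incidentᵇ v e))) (sym (ℕ.*-zeroʳ (endsAt v k + endsAt v (suc k))))
  ... | true = cong (_* 1) (trans (cong χ same-incidence) (χ-incidentᵇ v _ _ (step-not-loop k k<L)))
    where
    same-incidence : incidentᵇ v e ≡ incidentᵇ v (vtx W k , vtx W (suc k))
    same-incidence with stepOnᵇ-sound (vtx W k) (vtx W (suc k)) e uses
    ... | inj₁ p = cong (incidentᵇ v) (sym p)
    ... | inj₂ p = trans (cong (incidentᵇ v) (sym p)) (incidentᵇ-swap v (vtx W k , vtx W (suc k)))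

  step-incidences : ∀ v k → k < L → ∑ E (λ e → χ (incidentᵇ v e) * χ (usesᵇ k e)) ≡ endsAt v k + endsAt v (suc k)
  step-incidences v k k<L = begin
      ∑ E (λ e → χ (incidentᵇ v e) * χ (usesᵇ k e))   ≡⟨ ∑-cong E (step-endpoints v k k<L) ⟩
      ∑ E (λ e → c * χ (usesᵇ k e))                   ≡⟨ ∑-* E c (λ e → χ (usesᵇ k e)) ⟩
      c * ∑ E (λ e → χ (usesᵇ k e))                   ≡⟨ cong (c *_) (edges-per-step≡1 k k<L) ⟩
      c * 1                                           ≡⟨ ℕ.*-identityʳ c ⟩
      c                                               ∎
    where
    open ≡-Reasoning
    c = endsAt v k + endsAt v (suc k)

  incident-traversals : ∀ v → ∑ E (λ e → χ (incidentᵇ v e) * mult W e) ≡ visits v * 2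
  incident-traversals v = begin
      ∑ E (λ e → χ (incidentᵇ v e) * mult W e)
        ≡⟨ ∑-cong E (λ e → trans (cong (χ (incidentᵇ v e) *_) (mult≡∑ e)) (sym (∑-* (upTo L) (χ (incidentᵇ v e)) (λ k → χ (usesᵇ k e))))) ⟩
      ∑ E (λ e → ∑ (upTo L) (λ k → χ (incidentᵇ v e) * χ (usesᵇ k e)))
        ≡⟨ ∑-comm E (upTo L) (λ e k → χ (incidentᵇ v e) * χ (usesᵇ k e)) ⟩
      ∑ (upTo L) (λ k → ∑ E (λ e → χ (incidentᵇ v e) * χ (usesᵇ k e)))
        ≡⟨ ∑-congᴬ {xs = upTo L} (All.tabulate (λ {k} k∈ → step-incidences v k (∈-upTo⁻ k∈))) ⟩
      ∑ (upTo L) (λ k → endsAt v k + endsAt v (suc k))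
        ≡⟨ ∑-+ (upTo L) (endsAt v) (λ k → endsAt v (suc k)) ⟩
      visits v + ∑ (upTo L) (λ k → endsAt v (suc k))
        ≡⟨ cong (visits v +_) (∑-upTo-rotate L (endsAt v) (cong (λ z → χ (v ==V z)) (closed W))) ⟩
      visits v + visits v
        ≡⟨ n+n≡n*2 (visits v) ⟩
      visits v * 2 ∎
    where open ≡-Reasoning

  surplus+degree : ∀ v → surplus v + degreeIn E v ≡ visits v * 2
  surplus+degree v = begin
      surplus v + degreeIn E v
        ≡⟨ ∑-+ E (λ e → if incidentᵇ v e then excess e else 0) (endpointCount v) ⟨
      ∑ E (λ e → (if incidentᵇ v e then excess e else 0) + endpointCount v e)
        ≡⟨ ∑-congᴬ (All.tabulate (λ {e} e∈E → term e e∈E)) ⟩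
      ∑ E (λ e → χ (incidentᵇ v e) * mult W e)
        ≡⟨ incident-traversals v ⟩
      visits v * 2 ∎
    where
    open ≡-Reasoning
    term : ∀ e → e ∈ E → (if incidentᵇ v e then excess e else 0) + endpointCount v e ≡ χ (incidentᵇ v e) * mult W e
    term e e∈E = trans (cong ((if incidentᵇ v e then excess e else 0) +_) (sym (χ-incidentᵇ v (proj₁ e) (proj₂ e) (All.lookup loopless e∈E))))
                       (by-incidence (incidentᵇ v e))
      where
      by-incidence : ∀ b → (if b then excess e else 0) + χ b ≡ χ b * mult W e
      by-incidence true = trans (ℕ.m∸n+n≡m (mult-pos e e∈E)) (sym (ℕ.+-identityʳ _))
      by-incidence false = refl

  isOdd≤surplus : ∀ v → isOdd v ≤ surplus v
  isOdd≤surplus v with degreeIn E v % 2 ≡ᵇ 1 in odd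
  ... | false = z≤n
  ... | true with surplus v in surplus≡
  ...   | suc _ = s≤s z≤n
  ...   | zero = ⊥-elim (even-degree-not-odd (trans (cong (_% 2) degree≡) (m*n%n≡0 (visits v) 2)))
    where
    degree≡ : degreeIn E v ≡ visits v * 2
    degree≡ = trans (cong (_+ degreeIn E v) (sym surplus≡)) (surplus+degree v)
    even-degree-not-odd : degreeIn E v % 2 ≡ 0 → ⊥
    even-degree-not-odd even with trans (cong (_≡ᵇ 1) (sym even)) odd
    ... | ()

  endpoints-in-V≤2 : ∀ e → ∑ V (λ v → χ (incidentᵇ v e)) ≤ 2
  endpoints-in-V≤2 (a , b) = begin
      ∑ V (λ v → χ (incidentᵇ v (a , b)))      ≤⟨ ∑-monoᴬ {xs = V} (All.tabulate (λ {v} _ → χ-∨≤ (v ==V a) (v ==V b))) ⟩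
      ∑ V (λ v → χ (v ==V a) + χ (v ==V b))    ≡⟨ ∑-+ V _ _ ⟩
      ∑ V (λ v → χ (v ==V a)) + ∑ V (λ v → χ (v ==V b)) ≤⟨ ℕ.+-mono-≤ (occurs≤1 a) (occurs≤1 b) ⟩
      2                                       ∎
    where
    open ℕ.≤-Reasoning
    χ-∨≤ : ∀ x y → χ (x ∨ y) ≤ χ x + χ y
    χ-∨≤ true _ = s≤s z≤n
    χ-∨≤ false _ = ℕ.≤-refl
    occurs≤1 : ∀ x → ∑ V (λ v → χ (v ==V x)) ≤ 1
    occurs≤1 x = ∑≤1 (λ v → χ (v ==V x)) V-distinct (λ v → χ≤1 (v ==V x))
      (λ {v} {w} vx wx v≢w → v≢w (trans (==V⇒≡ v x (χ-pos⁻ vx)) (sym (==V⇒≡ w x (χ-pos⁻ wx)))))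

  ∑surplus≤2∑excess : ∑ V surplus ≤ ∑ E excess * 2
  ∑surplus≤2∑excess = begin
      ∑ V surplus
        ≡⟨ ∑-comm V E (λ v e → if incidentᵇ v e then excess e else 0) ⟩
      ∑ E (λ e → ∑ V (λ v → if incidentᵇ v e then excess e else 0))
        ≡⟨ ∑-cong E (λ e → trans (∑-cong V (λ v → if≡* (incidentᵇ v e) (excess e))) (∑-* V (excess e) (λ v → χ (incidentᵇ v e)))) ⟩
      ∑ E (λ e → excess e * ∑ V (λ v → χ (incidentᵇ v e)))
        ≤⟨ ∑-monoᴬ {xs = E} (All.tabulate (λ {e} _ → ℕ.*-monoʳ-≤ (excess e) (endpoints-in-V≤2 e))) ⟩
      ∑ E (λ e → excess e * 2)
        ≡⟨ ∑-cong E (λ e → ℕ.*-comm (excess e) 2) ⟩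
      ∑ E (λ e → 2 * excess e)
        ≡⟨ ∑-* E 2 excess ⟩
      2 * ∑ E excess
        ≡⟨ ℕ.*-comm 2 (∑ E excess) ⟩
      ∑ E excess * 2 ∎
    where
    open ℕ.≤-Reasoning
    if≡* : ∀ b c → (if b then c else 0) ≡ c * χ b
    if≡* true c = sym (ℕ.*-identityʳ c)
    if≡* false c = sym (ℕ.*-zeroʳ c)

  surplus≡isOdd : L ≤ length E + length (filterᵇ (λ v → degreeIn E v % 2 ≡ᵇ 1) V) / 2 →
                  All (λ v → surplus v ≡ isOdd v) V
  surplus≡isOdd tight = ∑-squeeze (All.tabulate (λ {v} _ → isOdd≤surplus v)) ∑surplus≤∑isOdd
    where
    open ℕ.≤-Reasoning
    odd = length (filterᵇ (λ v → degreeIn E v % 2 ≡ᵇ 1) V)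
    ∑excess≤odd/2 : ∑ E excess ≤ odd / 2
    ∑excess≤odd/2 = ℕ.+-cancelˡ-≤ (length E) _ _ (begin
        length E + ∑ E excess ≡⟨ ℕ.+-comm (length E) _ ⟩
        ∑ E excess + length E ≡⟨ ∑mult≡∑excess+|E| ⟨
        ∑ E (mult W)          ≤⟨ ∑mult≤L ⟩
        L                     ≤⟨ tight ⟩
        length E + odd / 2    ∎)
    ∑surplus≤∑isOdd : ∑ V surplus ≤ ∑ V isOdd
    ∑surplus≤∑isOdd = begin
        ∑ V surplus      ≤⟨ ∑surplus≤2∑excess ⟩
        ∑ E excess * 2   ≤⟨ ℕ.*-monoˡ-≤ 2 ∑excess≤odd/2 ⟩
        odd / 2 * 2      ≤⟨ m/n*n≤m odd 2 ⟩
        odd              ≡⟨ length-filterᵇ _ V ⟩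
        ∑ V isOdd        ∎

-- Closed vertex sequences give even degrees

lastOf : {A : Set} → A → List A → A
lastOf x [] = x
lastOf x (y ∷ ys) = lastOf y ys

lastOf-++ : {A : Set} (x : A) (zs ws : List A) → lastOf x (zs ++ ws) ≡ lastOf (lastOf x zs) ws
lastOf-++ x [] ws = refl
lastOf-++ x (z ∷ zs) ws = lastOf-++ z zs ws

pathEdges-++ : ∀ x xs y ys →
  pathEdges ((x ∷ xs) ++ (y ∷ ys)) ≡ pathEdges (x ∷ xs) ++ (lastOf x xs , y) ∷ pathEdges (y ∷ ys)
pathEdges-++ x [] y ys = refl
pathEdges-++ x (x′ ∷ xs) y ys = cong ((x , x′) ∷_) (pathEdges-++ x′ xs y ys)

-- Every vertex occurrence contributes two edge-ends, except that the two ends of the path contribute one.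
path-degree : ∀ v y ys →
  degreeIn (pathEdges (y ∷ ys)) v + χ (v ==V y) + χ (v ==V lastOf y ys) ≡ ∑ (y ∷ ys) (λ x → χ (v ==V x)) * 2
path-degree v y [] = rearrange (χ (v ==V y))
  where
  rearrange : ∀ a → 0 + a + a ≡ (a + 0) * 2
  rearrange = solve-∀
path-degree v y (y′ ∷ ys) = begin
    (a + a′ + D) + a + l        ≡⟨ rearrange a a′ D l ⟩
    a * 2 + (D + a′ + l)         ≡⟨ cong (a * 2 +_) (path-degree v y′ ys) ⟩
    a * 2 + ∑ (y′ ∷ ys) occ * 2  ≡⟨ ℕ.*-distribʳ-+ 2 a _ ⟨
    ∑ (y ∷ y′ ∷ ys) occ * 2      ∎
  where
  open ≡-Reasoning
  occ = λ x → χ (v ==V x)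
  a = occ y
  a′ = occ y′
  D = degreeIn (pathEdges (y′ ∷ ys)) v
  l = occ (lastOf y′ ys)
  rearrange : ∀ a a′ D l → (a + a′ + D) + a + l ≡ a * 2 + (D + a′ + l)
  rearrange = solve-∀

closed-path-even-degree : ∀ v y ys → lastOf y ys ≡ y → 2 ∣ degreeIn (pathEdges (y ∷ ys)) v
closed-path-even-degree v y ys closes = divides (C ∸ a) (sym (begin
    (C ∸ a) * 2          ≡⟨ ℕ.*-distribʳ-∸ 2 C a ⟩
    C * 2 ∸ a * 2        ≡⟨ cong (_∸ a * 2) (trans (cong (λ z → D + a + χ (v ==V z)) (sym closes)) (path-degree v y ys)) ⟨
    D + a + a ∸ a * 2    ≡⟨ cong (_∸ a * 2) (trans (ℕ.+-assoc D a a) (cong (D +_) (n+n≡n*2 a))) ⟩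
    D + a * 2 ∸ a * 2    ≡⟨ ℕ.m+n∸n≡m D (a * 2) ⟩
    D                    ∎))
  where
  open ≡-Reasoning
  D = degreeIn (pathEdges (y ∷ ys)) v
  a = χ (v ==V y)
  C = ∑ (y ∷ ys) (λ x → χ (v ==V x))

even+1-odd : ∀ {x} → 2 ∣ x → ((x + 1) % 2 ≡ᵇ 1) ≡ true
even+1-odd (divides k refl) = trans (cong (λ y → (y % 2) ≡ᵇ 1) (ℕ.+-comm (k * 2) 1)) (cong (_≡ᵇ 1) ([m+kn]%n≡m%n 1 k 2))

even-not-odd : ∀ {x} → 2 ∣ x → (x % 2 ≡ᵇ 1) ≡ false
even-not-odd (divides k refl) = cong (_≡ᵇ 1) (m*n%n≡0 k 2)

2∣∑ : {A : Set} {xs : List A} {f : A → ℕ} → All (λ x → 2 ∣ f x) xs → 2 ∣ ∑ xs f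
2∣∑ [] = divides 0 refl
2∣∑ (p ∷ ps) = ∣m∣n⇒∣m+n p (2∣∑ ps)

∈-concatMap⁻∃ : {A B : Set} (f : A → List B) {xs : List A} {y : B} → y ∈ concatMap f xs → ∃ λ x → (x ∈ xs) × (y ∈ f x)
∈-concatMap⁻∃ f = find ∘ ∈-concatMap⁻ f

∈-concatMap⁺∃ : {A B : Set} (f : A → List B) {xs : List A} {x : A} {y : B} → x ∈ xs → y ∈ f x → y ∈ concatMap f xs
∈-concatMap⁺∃ f x∈ y∈ = ∈-concatMap⁺ f (lose x∈ y∈)

All-concatMap⁺ : {A B : Set} {P : B → Set} (f : A → List B) {xs : List A} → All (λ x → All P (f x)) xs → All P (concatMap f xs)
All-concatMap⁺ f = All.concat⁺ ∘ All.map⁺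

one-to-suc : ∀ K → one-to (suc K) ≡ 1 ∷ map suc (one-to K)
one-to-suc K = cong (λ l → 1 ∷ map suc l) (sym (map-upTo suc K))

one-to-∷ʳ : ∀ K → one-to (suc K) ≡ one-to K ++ suc K ∷ []
one-to-∷ʳ K = trans (cong (map suc) (sym (upTo-∷ʳ K))) (map-++ suc (upTo K) (K ∷ []))

map-one-to-suc : {A : Set} (g : ℕ → A) (K : ℕ) → map g (one-to (suc K)) ≡ g 1 ∷ map (g ∘ suc) (one-to K)
map-one-to-suc g K = trans (cong (map g) (one-to-suc K)) (cong (g 1 ∷_) (sym (map-∘ (one-to K))))

∈-one-to⁻ : ∀ {x K} → x ∈ one-to K → (1 ≤ x) × (x ≤ K)
∈-one-to⁻ x∈ with ∈-map⁻ suc x∈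
... | y , y∈ , refl = s≤s z≤n , ∈-upTo⁻ y∈

∈-one-to⁺ : ∀ {x K} → 1 ≤ x → x ≤ K → x ∈ one-to K
∈-one-to⁺ {suc x} (s≤s _) x≤K = ∈-map⁺ suc (∈-upTo⁺ x≤K)

one-to-distinct : ∀ K → AllPairs _≢_ (one-to K)
one-to-distinct K = AllPairs.map⁺ (AllPairs.applyUpTo⁺₁ (λ i → i) K (λ i<j _ e → ℕ.<⇒≢ i<j (ℕ.suc-injective e)))

reverse-one-to-suc : ∀ K → reverse (one-to (suc K)) ≡ suc K ∷ reverse (one-to K)
reverse-one-to-suc K = trans (cong reverse (one-to-∷ʳ K)) (reverse-++ (one-to K) (suc K ∷ []))

∈-reverse-one-to⁻ : ∀ {x} K → x ∈ reverse (one-to K) → (1 ≤ x) × (x ≤ K)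
∈-reverse-one-to⁻ zero ()
∈-reverse-one-to⁻ (suc K) x∈ with subst (_ ∈_) (reverse-one-to-suc K) x∈
... | here refl = s≤s z≤n , ℕ.≤-refl
... | there x∈′ = map₂ ℕ.m≤n⇒m≤1+n (∈-reverse-one-to⁻ K x∈′)

reverse-one-to-distinct : ∀ K → AllPairs _≢_ (reverse (one-to K))
reverse-one-to-distinct zero = []
reverse-one-to-distinct (suc K) = subst (AllPairs _≢_) (sym (reverse-one-to-suc K))
  (All.tabulate (λ x∈ e → ℕ.<-irrefl (sym e) (s≤s (proj₂ (∈-reverse-one-to⁻ K x∈)))) ∷ reverse-one-to-distinct K)

Xcycle : ℕ → ℕ → List Edge
Xcycle i L = pathEdges (map (vt i) (one-to L) ++ map (vf i) (reverse (one-to L)) ++ vt i 1 ∷ [])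

tEdge fEdge : ℕ → ℕ → Edge
tEdge i k = (vt i k , vt i (suc k))
fEdge i k = (vf i (suc k) , vf i k)

Xlisted : ℕ → ℕ → List Edge
Xlisted i zero = []
Xlisted i (suc K) = map (tEdge i) (one-to K) ++ (vt i (suc K) , vf i (suc K)) ∷ (map (fEdge i) (reverse (one-to K)) ++ (vf i 1 , vt i 1) ∷ [])

pathEdges-map-one-to : ∀ K (g : ℕ → Vtx) → pathEdges (map g (one-to (suc K))) ≡ map (λ k → (g k , g (suc k))) (one-to K)
pathEdges-map-one-to zero g = refl
pathEdges-map-one-to (suc K) g = begin
    pathEdges (map g (one-to (suc (suc K))))
      ≡⟨ cong pathEdges (map-one-to-suc g (suc K)) ⟩
    pathEdges (g 1 ∷ map (g ∘ suc) (one-to (suc K)))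
      ≡⟨ cong (λ l → pathEdges (g 1 ∷ l)) (map-one-to-suc (g ∘ suc) K) ⟩
    (g 1 , g 2) ∷ pathEdges (g 2 ∷ map (g ∘ suc ∘ suc) (one-to K))
      ≡⟨ cong ((g 1 , g 2) ∷_) (trans (cong pathEdges (sym (map-one-to-suc (g ∘ suc) K))) (pathEdges-map-one-to K (g ∘ suc))) ⟩
    (g 1 , g 2) ∷ map (λ k → (g (suc k) , g (suc (suc k)))) (one-to K)
      ≡⟨ map-one-to-suc (λ k → (g k , g (suc k))) K ⟨
    map (λ k → (g k , g (suc k))) (one-to (suc K)) ∎
  where open ≡-Reasoning

pathEdges-map-reverse-one-to : ∀ K (g : ℕ → Vtx) →
  pathEdges (map g (reverse (one-to (suc K)))) ≡ map (λ k → (g (suc k) , g k)) (reverse (one-to K))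
pathEdges-map-reverse-one-to zero g = refl
pathEdges-map-reverse-one-to (suc K) g = begin
    pathEdges (map g (reverse (one-to (suc (suc K)))))
      ≡⟨ cong (λ l → pathEdges (map g l)) (reverse-one-to-suc (suc K)) ⟩
    pathEdges (g (suc (suc K)) ∷ map g (reverse (one-to (suc K))))
      ≡⟨ cong (λ l → pathEdges (g (suc (suc K)) ∷ map g l)) (reverse-one-to-suc K) ⟩
    (g (suc (suc K)) , g (suc K)) ∷ pathEdges (g (suc K) ∷ map g (reverse (one-to K)))
      ≡⟨ cong (λ l → (g (suc (suc K)) , g (suc K)) ∷ pathEdges (map g l)) (reverse-one-to-suc K) ⟨
    (g (suc (suc K)) , g (suc K)) ∷ pathEdges (map g (reverse (one-to (suc K))))
      ≡⟨ cong ((g (suc (suc K)) , g (suc K)) ∷_) (pathEdges-map-reverse-one-to K g) ⟩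
    (g (suc (suc K)) , g (suc K)) ∷ map (λ k → (g (suc k) , g k)) (reverse (one-to K))
      ≡⟨ cong (map (λ k → (g (suc k) , g k))) (reverse-one-to-suc K) ⟨
    map (λ k → (g (suc k) , g k)) (reverse (one-to (suc K))) ∎
  where open ≡-Reasoning

lastOf-map-one-to : ∀ K (g : ℕ → Vtx) → lastOf (g 1) (map (g ∘ suc) (one-to K)) ≡ g (suc K)
lastOf-map-one-to zero g = refl
lastOf-map-one-to (suc K) g = trans (cong (lastOf (g 1)) (map-one-to-suc (g ∘ suc) K)) (lastOf-map-one-to K (g ∘ suc))

lastOf-map-reverse-one-to : ∀ K (g : ℕ → Vtx) → lastOf (g (suc K)) (map g (reverse (one-to K))) ≡ g 1
lastOf-map-reverse-one-to zero g = refl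
lastOf-map-reverse-one-to (suc K) g =
  trans (cong (λ l → lastOf (g (suc (suc K))) (map g l)) (reverse-one-to-suc K)) (lastOf-map-reverse-one-to K g)

Xcycle≡Xlisted : ∀ i L → Xcycle i L ≡ Xlisted i L
Xcycle≡Xlisted i zero = refl
Xcycle≡Xlisted i (suc K) = begin
    Xcycle i (suc K)
      ≡⟨ cong (λ l → pathEdges (l ++ map (vf i) (reverse (one-to (suc K))) ++ vt i 1 ∷ [])) (map-one-to-suc (vt i) K) ⟩
    pathEdges ((vt i 1 ∷ ts) ++ map (vf i) (reverse (one-to (suc K))) ++ vt i 1 ∷ [])
      ≡⟨ cong (λ l → pathEdges ((vt i 1 ∷ ts) ++ map (vf i) l ++ vt i 1 ∷ [])) (reverse-one-to-suc K) ⟩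
    pathEdges ((vt i 1 ∷ ts) ++ vf i (suc K) ∷ fs ++ vt i 1 ∷ [])
      ≡⟨ pathEdges-++ (vt i 1) ts (vf i (suc K)) (fs ++ vt i 1 ∷ []) ⟩
    pathEdges (vt i 1 ∷ ts) ++ (lastOf (vt i 1) ts , vf i (suc K)) ∷ pathEdges (vf i (suc K) ∷ fs ++ vt i 1 ∷ [])
      ≡⟨ cong₂ _++_ tPart fPart ⟩
    Xlisted i (suc K) ∎
  where
  open ≡-Reasoning
  ts = map (vt i ∘ suc) (one-to K)
  fs = map (vf i) (reverse (one-to K))
  tPart : pathEdges (vt i 1 ∷ ts) ≡ map (tEdge i) (one-to K)
  tPart = trans (cong pathEdges (sym (map-one-to-suc (vt i) K))) (pathEdges-map-one-to K (vt i))
  fPart′ : pathEdges (vf i (suc K) ∷ fs ++ vt i 1 ∷ []) ≡ map (fEdge i) (reverse (one-to K)) ++ (vf i 1 , vt i 1) ∷ []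
  fPart′ = trans (pathEdges-++ (vf i (suc K)) fs (vt i 1) [])
    (cong₂ (λ a b → a ++ (b , vt i 1) ∷ [])
      (trans (cong (λ l → pathEdges (map (vf i) l)) (sym (reverse-one-to-suc K))) (pathEdges-map-reverse-one-to K (vf i)))
      (lastOf-map-reverse-one-to K (vf i)))
  fPart : (lastOf (vt i 1) ts , vf i (suc K)) ∷ pathEdges (vf i (suc K) ∷ fs ++ vt i 1 ∷ [])
        ≡ (vt i (suc K) , vf i (suc K)) ∷ (map (fEdge i) (reverse (one-to K)) ++ (vf i 1 , vt i 1) ∷ [])
  fPart = cong₂ (λ a b → (a , vf i (suc K)) ∷ b) (lastOf-map-one-to K (vt i)) fPart′

-- Distinctness of edges, separated by keys

HasKey : {K : Set} → (Edge → K) → K → Edge → Set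
HasKey key k e = (key e ≡ k) × (key (swap e) ≡ k)

module _ {K : Set} (key : Edge → K) where

  ≉-by-keyˡ : ∀ {k e e′} → HasKey key k e → key e′ ≢ k → e ≉ᴱ e′
  ≉-by-keyˡ (ke , _) ke′≢k (inj₁ refl) = ke′≢k ke
  ≉-by-keyˡ (_ , ks) ke′≢k (inj₂ refl) = ke′≢k ks

  ≉-by-keyʳ : ∀ {k e e′} → HasKey key k e′ → key e ≢ k → e ≉ᴱ e′
  ≉-by-keyʳ (ke′ , _) ke≢k (inj₁ refl) = ke≢k ke′
  ≉-by-keyʳ (_ , ks′) ke≢k (inj₂ refl) = ke≢k ks′

  keys-differ⇒≉ : ∀ {k k′ e e′} → HasKey key k e → key e′ ≡ k′ → k ≢ k′ → e ≉ᴱ e′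
  keys-differ⇒≉ ke ke′ k≢k′ = ≉-by-keyˡ ke (λ ke′≡k → k≢k′ (trans (sym ke′≡k) ke′))

  all-≉-by-key : ∀ {k xs ys} → All (HasKey key k) xs → All (λ e′ → key e′ ≢ k) ys → All (λ e → All (e ≉ᴱ_) ys) xs
  all-≉-by-key kxs kys = All.map (λ ke → All.map (≉-by-keyˡ ke) kys) kxs

module KeyedBlocks {B K : Set} {R : B → B → Set} (Keyed : K → B → Set)
  (separated : ∀ {k k′ x y} → k ≢ k′ → Keyed k x → Keyed k′ y → R x y) where

  AllPairs-++⁺ : ∀ {k k′ xs ys} → k ≢ k′ → All (Keyed k) xs → All (Keyed k′) ys →
                 AllPairs R xs → AllPairs R ys → AllPairs R (xs ++ ys)
  AllPairs-++⁺ k≢k′ kxs kys Rxs Rys = AllPairs.++⁺ Rxs Rys (All.map (λ kx → All.map (separated k≢k′ kx) kys) kxs)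

  AllPairs-concatMap⁺ : {A : Set} (tag : A → K) (f : A → List B) {as : List A} →
    AllPairs (λ a a′ → tag a ≢ tag a′) as → All (λ a → All (Keyed (tag a)) (f a)) as →
    All (λ a → AllPairs R (f a)) as → AllPairs R (concatMap f as)
  AllPairs-concatMap⁺ tag f [] [] [] = []
  AllPairs-concatMap⁺ tag f (tag≢ ∷ tags≢) (ka ∷ kas) (Ra ∷ Ras) =
    AllPairs.++⁺ Ra (AllPairs-concatMap⁺ tag f tags≢ kas Ras)
      (All.map (λ kx → All-concatMap⁺ f (All.zipWith (λ (t≢ , ka′) → All.map (separated t≢ kx) ka′) (tag≢ , kas))) ka)

module ByEdgeKey {K : Set} (key : Edge → K) =
  KeyedBlocks (HasKey key) (λ k≢k′ ke ke′ → keys-differ⇒≉ key ke (proj₁ ke′) k≢k′)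

module ByVertexKey {K : Set} (key : Vtx → K) =
  KeyedBlocks (λ k v → key v ≡ k) (λ k≢k′ kv kw v≡w → k≢k′ (trans (sym kv) (trans (cong key v≡w) kw)))

-- The layer of an edge is 0 on X and Y cycles, 1 on Z cycles, 2 on paths P and 3 on E*.
layer : Vtx → ℕ
layer (vt _ _) = 0
layer (vf _ _) = 0
layer (vc¹ _) = 1
layer (vc² _) = 1
layer (va _ _) = 1
layer (vb _ _) = 1
layer (vz _ _) = 2
layer vc* = 3

edgeLayer : Edge → ℕ
edgeLayer e = layer (proj₁ e) ⊔ layer (proj₂ e)

inE₀Layer : ℕ → Bool
inE₀Layer 0 = true
inE₀Layer 1 = true
inE₀Layer _ = false

tfCode : Vtx → ℕ
tfCode (vt _ _) = 0
tfCode (vf _ _) = 1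
tfCode _ = 5

tfShape : Edge → ℕ
tfShape e = tfCode (proj₁ e) + tfCode (proj₂ e)

variableIndex : Vtx → ℕ
variableIndex (vt i _) = i
variableIndex (vz i _) = i
variableIndex (vf i _) = i
variableIndex (va i _) = i
variableIndex (vb i _) = i
variableIndex _ = 0

position : Vtx → ℕ
position (vt _ ℓ) = ℓ
position (vz _ ℓ) = ℓ
position (vf _ ℓ) = ℓ
position _ = 0

-- The i of the block X_i ∪ Y_{i i'} containing an edge: an edge starting at position 1
-- may be a Y-edge leaving block i' = nxt i, and then its other end lies in block i.
blockOwner : Edge → ℕ
blockOwner e = if position (proj₁ e) ≡ᵇ 1 then variableIndex (proj₂ e) else variableIndex (proj₁ e)

Ycycle : ℕ → ℕ → ℕ → List Edge
Ycycle i i′ L = pathEdges (vt i L ∷ vf i′ 1 ∷ vf i L ∷ vt i′ 1 ∷ vt i L ∷ [])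

XYcycles : ℕ → ℕ → ℕ → List Edge
XYcycles i i′ L = Xlisted i L ++ Ycycle i i′ L

2+n≢n : ∀ {n} → suc (suc n) ≢ n
2+n≢n ()

∈-tEdges : ∀ {i K e} → e ∈ map (tEdge i) (one-to K) → ∃ λ k → (1 ≤ k) × (k ≤ K) × (e ≡ tEdge i k)
∈-tEdges e∈ with ∈-map⁻ _ e∈
... | k , k∈ , refl = k , proj₁ (∈-one-to⁻ k∈) , proj₂ (∈-one-to⁻ k∈) , refl

∈-fEdges : ∀ {i K e} → e ∈ map (fEdge i) (reverse (one-to K)) → ∃ λ k → (1 ≤ k) × (k ≤ K) × (e ≡ fEdge i k)
∈-fEdges {K = K} e∈ with ∈-map⁻ _ e∈
... | k , k∈ , refl = k , proj₁ (∈-reverse-one-to⁻ K k∈) , proj₂ (∈-reverse-one-to⁻ K k∈) , refl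

tEdges-distinct : ∀ i K → AllPairs _≉ᴱ_ (map (tEdge i) (one-to K))
tEdges-distinct i K = AllPairs.map⁺ (AllPairs.map apart (one-to-distinct K))
  where
  apart : ∀ {a b} → a ≢ b → tEdge i a ≉ᴱ tEdge i b
  apart a≢b (inj₁ refl) = a≢b refl
  apart a≢b (inj₂ e) = 2+n≢n (trans (cong (suc ∘ position ∘ proj₁) (sym e)) (cong (position ∘ proj₂) e))

fEdges-distinct : ∀ i K → AllPairs _≉ᴱ_ (map (fEdge i) (reverse (one-to K)))
fEdges-distinct i K = AllPairs.map⁺ (AllPairs.map apart (reverse-one-to-distinct K))
  where
  apart : ∀ {a b} → a ≢ b → fEdge i a ≉ᴱ fEdge i b
  apart a≢b (inj₁ refl) = a≢b refl
  apart a≢b (inj₂ e) = 2+n≢n (trans (cong (suc ∘ position ∘ proj₂) (sym e)) (cong (position ∘ proj₁) e))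

-- The cycles X_i have length 2L with L = 6 μ_i ≥ 3, which keeps their edges apart from those of Y_{i i'}.
module _ (i i′ K : ℕ) where

  private
    L = 3 + K
    ts = map (tEdge i) (one-to (2 + K))
    fs = map (fEdge i) (reverse (one-to (2 + K)))

    ts-t–t : All (HasKey tfShape 0) ts
    ts-t–t = All.tabulate (λ e∈ → t–t (∈-tEdges e∈))
      where
      t–t : ∀ {e} → (∃ λ k → (1 ≤ k) × (k ≤ 2 + K) × (e ≡ tEdge i k)) → HasKey tfShape 0 e
      t–t (_ , _ , _ , refl) = refl , refl

    fs-f–f : All (HasKey tfShape 2) fs
    fs-f–f = All.tabulate (λ e∈ → f–f (∈-fEdges {K = 2 + K} e∈))
      where
      f–f : ∀ {e} → (∃ λ k → (1 ≤ k) × (k ≤ 2 + K) × (e ≡ fEdge i k)) → HasKey tfShape 2 e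
      f–f (_ , _ , _ , refl) = refl , refl

  Y-distinct : AllPairs _≉ᴱ_ (Ycycle i i′ L)
  Y-distinct = ((λ { (inj₁ ()) ; (inj₂ ()) }) ∷ (λ { (inj₁ ()) ; (inj₂ ()) }) ∷ (λ { (inj₁ ()) ; (inj₂ ()) }) ∷ [])
             ∷ ((λ { (inj₁ ()) ; (inj₂ ()) }) ∷ (λ { (inj₁ ()) ; (inj₂ ()) }) ∷ [])
             ∷ ((λ { (inj₁ ()) ; (inj₂ ()) }) ∷ [])
             ∷ [] ∷ []

  X-distinct : AllPairs _≉ᴱ_ (Xlisted i L)
  X-distinct = AllPairs.++⁺ (tEdges-distinct i (2 + K)) rungOnwards
    (all-≉-by-key tfShape ts-t–t ((λ ()) ∷ All.++⁺ (All.map (λ ke 0≡2 → 0≢2 (trans (sym 0≡2) (proj₁ ke))) fs-f–f) ((λ ()) ∷ [])))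
    where
    0≢2 : 0 ≢ 2
    0≢2 ()
    closing : AllPairs _≉ᴱ_ (fs ++ (vf i 1 , vt i 1) ∷ [])
    closing = AllPairs.++⁺ (fEdges-distinct i (2 + K)) ([] ∷ []) (all-≉-by-key tfShape fs-f–f ((λ ()) ∷ []))
    rungOnwards : AllPairs _≉ᴱ_ ((vt i L , vf i L) ∷ fs ++ (vf i 1 , vt i 1) ∷ [])
    rungOnwards = All.++⁺ (All.map (λ ke → ≉-by-keyʳ tfShape ke (λ ())) fs-f–f) ((λ { (inj₁ ()) ; (inj₂ ()) }) ∷ []) ∷ closing

  X-Y-apart : All (λ e → All (e ≉ᴱ_) (Ycycle i i′ L)) (Xlisted i L)
  X-Y-apart = All.++⁺ ts-apart
    (((λ { (inj₁ ()) ; (inj₂ ()) }) ∷ (λ { (inj₁ ()) ; (inj₂ ()) }) ∷ (λ { (inj₁ ()) ; (inj₂ ()) }) ∷ (λ { (inj₁ ()) ; (inj₂ ()) }) ∷ [])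
     ∷ All.++⁺ fs-apart
       (((λ { (inj₁ ()) ; (inj₂ ()) }) ∷ (λ { (inj₁ ()) ; (inj₂ ()) }) ∷ (λ { (inj₁ ()) ; (inj₂ ()) }) ∷ (λ { (inj₁ ()) ; (inj₂ ()) }) ∷ []) ∷ []))
    where
    ts-apart : All (λ e → All (e ≉ᴱ_) (Ycycle i i′ L)) ts
    ts-apart = All.tabulate λ e∈ → let ke = All.lookup ts-t–t e∈ in
        ≉-by-keyˡ tfShape ke (λ ()) ∷ ≉-by-keyˡ tfShape ke (λ ()) ∷ ≉-by-keyˡ tfShape ke (λ ()) ∷ apart (∈-tEdges e∈) ∷ []
      where
      apart : ∀ {e} → (∃ λ k → (1 ≤ k) × (k ≤ 2 + K) × (e ≡ tEdge i k)) → e ≉ᴱ (vt i′ 1 , vt i L)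
      apart (_ , _ , _ , refl) = λ { (inj₁ ()) ; (inj₂ ()) }
    fs-apart : All (λ e → All (e ≉ᴱ_) (Ycycle i i′ L)) fs
    fs-apart = All.tabulate λ e∈ → let ke = All.lookup fs-f–f e∈ in
        ≉-by-keyˡ tfShape ke (λ ()) ∷ apart (∈-fEdges {K = 2 + K} e∈) ∷ ≉-by-keyˡ tfShape ke (λ ()) ∷ ≉-by-keyˡ tfShape ke (λ ()) ∷ []
      where
      apart : ∀ {e} → (∃ λ k → (1 ≤ k) × (k ≤ 2 + K) × (e ≡ fEdge i k)) → e ≉ᴱ (vf i′ 1 , vf i L)
      apart (_ , _ , _ , refl) = λ { (inj₁ ()) ; (inj₂ ()) }

  XYcycles-distinct : AllPairs _≉ᴱ_ (XYcycles i i′ L)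
  XYcycles-distinct = AllPairs.++⁺ X-distinct Y-distinct X-Y-apart

All-XYcycles : (P : Edge → Set) (i i′ K : ℕ) →
  (∀ k → 1 ≤ k → k ≤ K → P (tEdge i k)) → P (vt i (suc K) , vf i (suc K)) →
  (∀ k → 1 ≤ k → k ≤ K → P (fEdge i k)) → P (vf i 1 , vt i 1) →
  P (vt i (suc K) , vf i′ 1) → P (vf i′ 1 , vf i (suc K)) → P (vf i (suc K) , vt i′ 1) → P (vt i′ 1 , vt i (suc K)) →
  All P (XYcycles i i′ (suc K))
All-XYcycles P i i′ K onT rung onF closing y₁ y₂ y₃ y₄ =
  All.++⁺ (All.++⁺ (All.tabulate (λ e∈ → let (k , 1≤k , k≤K , e≡) = ∈-tEdges e∈ in subst P (sym e≡) (onT k 1≤k k≤K)))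
                   (rung ∷ All.++⁺ (All.tabulate (λ e∈ → let (k , 1≤k , k≤K , e≡) = ∈-fEdges {K = K} e∈ in subst P (sym e≡) (onF k 1≤k k≤K)))
                                   (closing ∷ [])))
          (y₁ ∷ y₂ ∷ y₃ ∷ y₄ ∷ [])

XYcycles-layer : ∀ i i′ K → All (HasKey edgeLayer 0) (XYcycles i i′ (suc K))
XYcycles-layer i i′ K = All-XYcycles (HasKey edgeLayer 0) i i′ K
  (λ _ _ _ → refl , refl) (refl , refl) (λ _ _ _ → refl , refl) (refl , refl) (refl , refl) (refl , refl) (refl , refl) (refl , refl)

XYcycles-owner : ∀ i i′ K → All (HasKey blockOwner i) (XYcycles i i′ (3 + K))
XYcycles-owner i i′ K = All-XYcycles (HasKey blockOwner i) i i′ (2 + K)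
  (λ k _ _ → if-same (k ≡ᵇ 1) , if-same (suc k ≡ᵇ 1)) (refl , refl)
  (λ k _ _ → if-same _ , if-same _) (refl , refl)
  (refl , refl) (refl , refl) (refl , refl) (refl , refl)
  where
  if-same : (b : Bool) → (if b then i else i) ≡ i
  if-same true = refl
  if-same false = refl

InXYBlock : ℕ → ℕ → ℕ → Vtx → Set
InXYBlock i i′ L v = (∃ λ ℓ → (1 ≤ ℓ) × (ℓ ≤ L) × ((v ≡ vt i ℓ) ⊎ (v ≡ vf i ℓ))) ⊎ ((v ≡ vt i′ 1) ⊎ (v ≡ vf i′ 1))

XYEdgeShape : ℕ → ℕ → ℕ → Edge → Set
XYEdgeShape i i′ L e = (proj₁ e ≢ proj₂ e) × InXYBlock i i′ L (proj₁ e) × InXYBlock i i′ L (proj₂ e)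

XYcycles-shape : ∀ i i′ K → All (XYEdgeShape i i′ (3 + K)) (XYcycles i i′ (3 + K))
XYcycles-shape i i′ K = All-XYcycles (XYEdgeShape i i′ (3 + K)) i i′ (2 + K)
  (λ k 1≤k k≤K → (λ e → ℕ.1+n≢n (sym (cong position e))) , t k 1≤k (ℕ.m≤n⇒m≤1+n k≤K) , t (suc k) (s≤s z≤n) (s≤s k≤K))
  ((λ ()) , t (3 + K) (s≤s z≤n) ℕ.≤-refl , f (3 + K) (s≤s z≤n) ℕ.≤-refl)
  (λ k 1≤k k≤K → (λ e → ℕ.1+n≢n (cong position e)) , f (suc k) (s≤s z≤n) (s≤s k≤K) , f k 1≤k (ℕ.m≤n⇒m≤1+n k≤K))
  ((λ ()) , f 1 (s≤s z≤n) (s≤s z≤n) , t 1 (s≤s z≤n) (s≤s z≤n))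
  ((λ ()) , t (3 + K) (s≤s z≤n) ℕ.≤-refl , inj₂ (inj₂ refl))
  ((λ ()) , inj₂ (inj₂ refl) , f (3 + K) (s≤s z≤n) ℕ.≤-refl)
  ((λ ()) , f (3 + K) (s≤s z≤n) ℕ.≤-refl , inj₂ (inj₁ refl))
  ((λ ()) , inj₂ (inj₁ refl) , t (3 + K) (s≤s z≤n) ℕ.≤-refl)
  where
  t : ∀ ℓ → 1 ≤ ℓ → ℓ ≤ 3 + K → InXYBlock i i′ (3 + K) (vt i ℓ)
  f : ∀ ℓ → 1 ≤ ℓ → ℓ ≤ 3 + K → InXYBlock i i′ (3 + K) (vf i ℓ)
  t ℓ 1≤ℓ ℓ≤L = inj₁ (ℓ , 1≤ℓ , ℓ≤L , inj₁ refl)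
  f ℓ 1≤ℓ ℓ≤L = inj₁ (ℓ , 1≤ℓ , ℓ≤L , inj₂ refl)

6ℓ∸k∈one-to-6μ : ∀ k {ℓ μ} → k < 6 → 1 ≤ ℓ → ℓ ≤ μ → 6 * ℓ ∸ k ∈ one-to (6 * μ)
6ℓ∸k∈one-to-6μ k {ℓ} k<6 1≤ℓ ℓ≤μ = ∈-one-to⁺
  (ℕ.m<n⇒0<n∸m (ℕ.<-≤-trans k<6 (ℕ.*-monoʳ-≤ 6 1≤ℓ)))
  (ℕ.≤-trans (ℕ.m∸n≤m (6 * ℓ) k) (ℕ.*-monoʳ-≤ 6 ℓ≤μ))

6[1+x]∸3≢6[1+x]∸2 : ∀ x → 6 * suc x ∸ 3 ≢ 6 * suc x ∸ 2
6[1+x]∸3≢6[1+x]∸2 x = subst (λ y → y ∸ 3 ≢ y ∸ 2) (sym (ℕ.*-suc 6 x)) (ℕ.1+n≢n ∘ sym)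

literalVertex : Bool → ℕ → ℕ → Vtx
literalVertex s = if s then vt else vf

Zcycle : Bool → ℕ → ℕ → ℕ → ℕ → List Edge
Zcycle s i j a b = pathEdges (literalVertex s i a ∷ vc¹ j ∷ va i j ∷ vc² j ∷ literalVertex s i b ∷ vb i j ∷ literalVertex s i a ∷ [])

inClauseGadget : Vtx → Bool
inClauseGadget (vc¹ _) = true
inClauseGadget (vc² _) = true
inClauseGadget (va _ _) = true
inClauseGadget (vb _ _) = true
inClauseGadget _ = false

clauseIndex : Vtx → ℕ
clauseIndex (vc¹ j) = j
clauseIndex (vc² j) = j
clauseIndex (va _ j) = j
clauseIndex (vb _ j) = j
clauseIndex _ = 0

clauseOf : Edge → ℕ
clauseOf e = if inClauseGadget (proj₁ e) then clauseIndex (proj₁ e) else clauseIndex (proj₂ e)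

hasVariable : Vtx → Bool
hasVariable (vt _ _) = true
hasVariable (vf _ _) = true
hasVariable (va _ _) = true
hasVariable (vb _ _) = true
hasVariable _ = false

variableOf : Edge → ℕ
variableOf e = if hasVariable (proj₁ e) then variableIndex (proj₁ e) else variableIndex (proj₂ e)

isC : Vtx → Bool
isC (vc¹ _) = true
isC (vc² _) = true
isC _ = false

NotC–C : Edge → Set
NotC–C e = (isC (proj₁ e) ∧ isC (proj₂ e)) ≡ false

Zcycle-distinct : ∀ s i j a b → a ≢ b → AllPairs _≉ᴱ_ (Zcycle s i j a b)
Zcycle-distinct true i j a b a≢b =
    ((λ { (inj₁ ()) ; (inj₂ ()) }) ∷ (λ { (inj₁ ()) ; (inj₂ ()) }) ∷ (λ { (inj₁ ()) ; (inj₂ ()) }) ∷ (λ { (inj₁ ()) ; (inj₂ ()) }) ∷ (λ { (inj₁ ()) ; (inj₂ ()) }) ∷ [])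
  ∷ ((λ { (inj₁ ()) ; (inj₂ ()) }) ∷ (λ { (inj₁ ()) ; (inj₂ ()) }) ∷ (λ { (inj₁ ()) ; (inj₂ ()) }) ∷ (λ { (inj₁ ()) ; (inj₂ ()) }) ∷ [])
  ∷ ((λ { (inj₁ ()) ; (inj₂ ()) }) ∷ (λ { (inj₁ ()) ; (inj₂ ()) }) ∷ (λ { (inj₁ ()) ; (inj₂ ()) }) ∷ [])
  ∷ ((λ { (inj₁ ()) ; (inj₂ ()) }) ∷ (λ { (inj₁ ()) ; (inj₂ ()) }) ∷ [])
  ∷ ((λ { (inj₁ ()) ; (inj₂ refl) → a≢b refl }) ∷ [])
  ∷ [] ∷ []
Zcycle-distinct false i j a b a≢b =
    ((λ { (inj₁ ()) ; (inj₂ ()) }) ∷ (λ { (inj₁ ()) ; (inj₂ ()) }) ∷ (λ { (inj₁ ()) ; (inj₂ ()) }) ∷ (λ { (inj₁ ()) ; (inj₂ ()) }) ∷ (λ { (inj₁ ()) ; (inj₂ ()) }) ∷ [])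
  ∷ ((λ { (inj₁ ()) ; (inj₂ ()) }) ∷ (λ { (inj₁ ()) ; (inj₂ ()) }) ∷ (λ { (inj₁ ()) ; (inj₂ ()) }) ∷ (λ { (inj₁ ()) ; (inj₂ ()) }) ∷ [])
  ∷ ((λ { (inj₁ ()) ; (inj₂ ()) }) ∷ (λ { (inj₁ ()) ; (inj₂ ()) }) ∷ (λ { (inj₁ ()) ; (inj₂ ()) }) ∷ [])
  ∷ ((λ { (inj₁ ()) ; (inj₂ ()) }) ∷ (λ { (inj₁ ()) ; (inj₂ ()) }) ∷ [])
  ∷ ((λ { (inj₁ ()) ; (inj₂ refl) → a≢b refl }) ∷ [])
  ∷ [] ∷ []

ZEdgeKeys : ℕ → ℕ → Edge → Set
ZEdgeKeys i j e = HasKey edgeLayer 1 e × HasKey clauseOf j e × HasKey variableOf i e × NotC–C e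

Zcycle-keys : ∀ s i j a b → All (ZEdgeKeys i j) (Zcycle s i j a b)
Zcycle-keys true i j a b = keys ∷ keys ∷ keys ∷ keys ∷ keys ∷ keys ∷ []
  where keys = (refl , refl) , (refl , refl) , (refl , refl) , refl
Zcycle-keys false i j a b = keys ∷ keys ∷ keys ∷ keys ∷ keys ∷ keys ∷ []
  where keys = (refl , refl) , (refl , refl) , (refl , refl) , refl

pathVariable pathIndex : Edge → ℕ
pathVariable e = variableIndex (proj₁ e)
pathIndex e = position (proj₁ e)

Ppath : ℕ → ℕ → List Edge
Ppath i ℓ = (vt i ℓ , vz i ℓ) ∷ (vz i ℓ , vf i ℓ) ∷ []

Ppath-distinct : ∀ i ℓ → AllPairs _≉ᴱ_ (Ppath i ℓ)
Ppath-distinct i ℓ = ((λ { (inj₁ ()) ; (inj₂ ()) }) ∷ []) ∷ [] ∷ []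

PEdgeKeys : ℕ → ℕ → Edge → Set
PEdgeKeys i ℓ e = HasKey edgeLayer 2 e × HasKey pathVariable i e × HasKey pathIndex ℓ e × NotC–C e × (proj₁ e ≢ proj₂ e)

Ppath-keys : ∀ i ℓ → All (PEdgeKeys i ℓ) (Ppath i ℓ)
Ppath-keys i ℓ = ((refl , refl) , (refl , refl) , (refl , refl) , refl , (λ ())) ∷ ((refl , refl) , (refl , refl) , (refl , refl) , refl , (λ ())) ∷ []

isStar : Vtx → Bool
isStar vc* = true
isStar _ = false

starClause : Edge → ℕ
starClause e = if isStar (proj₁ e) then clauseIndex (proj₂ e) else clauseIndex (proj₁ e)

starPair : ℕ → List Edge
starPair j = (vc¹ j , vc*) ∷ (vc* , vc² j) ∷ []

starPair-distinct : ∀ j → AllPairs _≉ᴱ_ (starPair j)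
starPair-distinct j = ((λ { (inj₁ ()) ; (inj₂ ()) }) ∷ []) ∷ [] ∷ []

StarEdgeKeys : ℕ → Edge → Set
StarEdgeKeys j e = HasKey edgeLayer 3 e × HasKey starClause j e × NotC–C e × (proj₁ e ≢ proj₂ e)

starPair-keys : ∀ j → All (StarEdgeKeys j) (starPair j)
starPair-keys j = ((refl , refl) , (refl , refl) , refl , (λ ())) ∷ ((refl , refl) , (refl , refl) , refl , (λ ())) ∷ []

indexedBy : {A : Set} → (ℕ → ℕ) → List A → List (ℕ × A)
indexedBy g [] = []
indexedBy g (x ∷ xs) = (g 1 , x) ∷ indexedBy (g ∘ suc) xs

zip-indexedBy : {A : Set} (g : ℕ → ℕ) (xs : List A) → zip (map g (one-to (length xs))) xs ≡ indexedBy g xs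
zip-indexedBy g [] = refl
zip-indexedBy g (x ∷ xs) =
  trans (cong (λ l → zip l (x ∷ xs)) (map-one-to-suc g (length xs))) (cong ((g 1 , x) ∷_) (zip-indexedBy (g ∘ suc) xs))

indexed≡indexedBy-id : {A : Set} (xs : List A) → indexed xs ≡ indexedBy (λ t → t) xs
indexed≡indexedBy-id xs = trans (cong (λ l → zip l xs) (sym (map-id (one-to (length xs))))) (zip-indexedBy (λ t → t) xs)

∈-indexedBy⁻ : {A : Set} (g : ℕ → ℕ) (xs : List A) {j : ℕ} {x : A} → (j , x) ∈ indexedBy g xs →
  ∃₂ λ pre post → (xs ≡ pre ++ x ∷ post) × (j ≡ g (suc (length pre)))
∈-indexedBy⁻ g (x ∷ xs) (here refl) = [] , xs , refl , refl
∈-indexedBy⁻ g (x ∷ xs) (there jx∈) with ∈-indexedBy⁻ (g ∘ suc) xs jx∈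
... | pre , post , xs≡ , j≡ = x ∷ pre , post , cong (x ∷_) xs≡ , j≡

∈-indexed⁻ : {A : Set} {xs : List A} {j : ℕ} {x : A} → (j , x) ∈ indexed xs →
  ∃₂ λ pre post → (xs ≡ pre ++ x ∷ post) × (j ≡ suc (length pre))
∈-indexed⁻ {xs = xs} jx∈ = ∈-indexedBy⁻ (λ t → t) xs (subst (_ ∈_) (indexed≡indexedBy-id xs) jx∈)

indexedBy-distinct : {A : Set} (g : ℕ → ℕ) → (∀ {a b} → g a ≡ g b → a ≡ b) → (xs : List A) →
  AllPairs (λ a b → proj₁ a ≢ proj₁ b) (indexedBy g xs)
indexedBy-distinct g g-inj [] = []
indexedBy-distinct g g-inj (x ∷ xs) =
  All.tabulate later-index ∷ indexedBy-distinct (g ∘ suc) (ℕ.suc-injective ∘ g-inj) xs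
  where
  later-index : ∀ {y} → y ∈ indexedBy (g ∘ suc) xs → g 1 ≢ proj₁ y
  later-index y∈ g1≡ with ∈-indexedBy⁻ (g ∘ suc) xs y∈
  ... | pre , post , _ , j≡ with g-inj (trans g1≡ j≡)
  ... | ()

indexed-distinct : {A : Set} (xs : List A) → AllPairs (λ a b → proj₁ a ≢ proj₁ b) (indexed xs)
indexed-distinct xs = subst (AllPairs _) (sym (indexed≡indexedBy-id xs)) (indexedBy-distinct (λ t → t) (λ e → e) xs)

AllPairs-map-∈ : {A : Set} {R Q : A → A → Set} {xs : List A} →
  (∀ {a b} → a ∈ xs → b ∈ xs → R a b → Q a b) → AllPairs R xs → AllPairs Q xs
AllPairs-map-∈ R⇒Q [] = []
AllPairs-map-∈ R⇒Q (Rx ∷ Rxs) =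
  All.tabulate (λ y∈ → R⇒Q (here refl) (there y∈) (All.lookup Rx y∈)) ∷ AllPairs-map-∈ (λ a∈ b∈ → R⇒Q (there a∈) (there b∈)) Rxs

take-length-++ : {A : Set} (pre ys : List A) → take (length pre) (pre ++ ys) ≡ pre
take-length-++ [] ys = refl
take-length-++ (x ∷ pre) ys = cong (x ∷_) (take-length-++ pre ys)

length-filterᵇ-++ : {A : Set} (p : A → Bool) (xs ys : List A) →
  length (filterᵇ p (xs ++ ys)) ≡ length (filterᵇ p xs) + length (filterᵇ p ys)
length-filterᵇ-++ p xs ys = trans (cong length (filter-++ (T? ∘ p) xs ys)) (length-++ (filterᵇ p xs))

filterᵇ-rank≤ : ∀ {A : Set} (p : A → Bool) (pre post : List A) (C : A) → p C ≡ true →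
  suc (length (filterᵇ p (take (length pre) (pre ++ C ∷ post)))) ≤ length (filterᵇ p (pre ++ C ∷ post))
filterᵇ-rank≤ p pre post C pC = begin
    suc (length (filterᵇ p (take (length pre) (pre ++ C ∷ post))))
      ≡⟨ cong (λ l → suc (length (filterᵇ p l))) (take-length-++ pre (C ∷ post)) ⟩
    suc (length (filterᵇ p pre))                              ≡⟨ ℕ.+-comm 1 _ ⟩
    length (filterᵇ p pre) + 1                                ≤⟨ ℕ.+-monoʳ-≤ (length (filterᵇ p pre)) C-counted ⟩
    length (filterᵇ p pre) + length (filterᵇ p (C ∷ post))    ≡⟨ length-filterᵇ-++ p pre (C ∷ post) ⟨
    length (filterᵇ p (pre ++ C ∷ post))                      ∎
  where
  open ℕ.≤-Reasoning
  C-counted : 1 ≤ length (filterᵇ p (C ∷ post))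
  C-counted rewrite pC = s≤s z≤n

∈-filterᵇ⁻ : {A : Set} (p : A → Bool) {xs : List A} {x : A} → x ∈ filterᵇ p xs → (x ∈ xs) × (p x ≡ true)
∈-filterᵇ⁻ p x∈ = map₂ (Equivalence.to T-≡) (∈-filter⁻ (T? ∘ p) x∈)

any≡false⁻ : {A : Set} (p : A → Bool) {xs : List A} {x : A} → any p xs ≡ false → x ∈ xs → p x ≡ false
any≡false⁻ p {x = x} none x∈ with p x in px
... | false = refl
... | true = ⊥-elim (subst T none (any⁺ p (lose x∈ (Equivalence.from T-≡ px))))

any≡true⁺ : {A : Set} (p : A → Bool) {xs : List A} {x : A} → x ∈ xs → p x ≡ true → any p xs ≡ true
any≡true⁺ p x∈ px = Equivalence.to T-≡ (any⁺ p (lose x∈ (Equivalence.from T-≡ px)))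

≡ᵇ-refl : ∀ n → (n ≡ᵇ n) ≡ true
≡ᵇ-refl n = Equivalence.to T-≡ (ℕ.≡⇒≡ᵇ n n refl)

module Instance (φ : Formula) (wf : WellFormed φ) where
  open Construction φ

  ∈-rem⁻ : ∀ {C} → C ∈ rem → (C ∈ clauses φ) × (tautological C ≡ false)
  ∈-rem⁻ C∈ = map₂ not≡true⁻ (∈-filterᵇ⁻ (λ C → not (tautological C)) C∈)
    where
    not≡true⁻ : ∀ {b} → not b ≡ true → b ≡ false
    not≡true⁻ {false} _ = refl

  literal-in-range : ∀ {C l} → C ∈ rem → l ∈ C → (1 ≤ proj₁ l) × (proj₁ l ≤ n)
  literal-in-range C∈ l∈ = All.lookup (proj₂ (proj₂ (All.lookup (proj₁ wf) (proj₁ (∈-rem⁻ C∈))))) l∈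

  -- A clause lists no literal twice, and no two literals x_i, x̄_i since tautologies were removed.
  clause-variables-distinct : ∀ {C} → C ∈ rem → AllPairs (λ l l′ → proj₁ l ≢ proj₁ l′) C
  clause-variables-distinct {C} C∈ = AllPairs-map-∈ same-variable⇒same (proj₁ (proj₂ (All.lookup (proj₁ wf) (proj₁ (∈-rem⁻ C∈)))))
    where
    same-variable⇒same : ∀ {l l′} → l ∈ C → l′ ∈ C → l ≢ l′ → proj₁ l ≢ proj₁ l′
    same-variable⇒same {i , s} {_ , s′} l∈ l′∈ l≢l′ refl = l≢l′ (cong (i ,_) (xor≡false⁻ s s′ s-xor-s′))
      where
      xor≡false⁻ : ∀ a b → (a xor b) ≡ false → a ≡ b
      xor≡false⁻ true true _ = refl
      xor≡false⁻ false false _ = refl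
      s-xor-s′ : (s xor s′) ≡ false
      s-xor-s′ = subst (λ b → (b ∧ (s xor s′)) ≡ false) (≡ᵇ-refl i)
        (any≡false⁻ _ (any≡false⁻ _ (proj₂ (∈-rem⁻ C∈)) l∈) l′∈)

  ∈-indexed-rem⇒∈rem : ∀ {j C} → (j , C) ∈ indexed rem → C ∈ rem
  ∈-indexed-rem⇒∈rem jC∈ with ∈-indexed⁻ jC∈
  ... | pre , post , rem≡ , _ = subst (_ ∈_) (sym rem≡) (∈-++⁺ʳ pre (here refl))

  ∈-indexed-rem⇒∈one-to-m : ∀ {j C} → (j , C) ∈ indexed rem → j ∈ one-to m
  ∈-indexed-rem⇒∈one-to-m jC∈ with ∈-indexed⁻ jC∈
  ... | pre , post , rem≡ , refl = ∈-one-to⁺ (s≤s z≤n)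
    (subst (suc (length pre) ≤_) (sym (trans (cong length rem≡) (length-++ pre)))
      (subst (_≤ length pre + suc (length post)) (ℕ.+-comm (length pre) 1) (ℕ.+-monoʳ-≤ (length pre) (s≤s z≤n))))

  pos≤μ : ∀ {j C l} → (j , C) ∈ indexed rem → l ∈ C → pos (proj₁ l) j ≤ μ (proj₁ l)
  pos≤μ {C = C} {l} jC∈ l∈ with ∈-indexed⁻ jC∈
  ... | pre , post , rem≡ , refl = subst (λ R → suc (length (filterᵇ p (take (length pre) R))) ≤ length (filterᵇ p R)) (sym rem≡)
          (filterᵇ-rank≤ p pre post C (any≡true⁺ _ l∈ (≡ᵇ-refl (proj₁ l))))
    where p = mentions (proj₁ l)

  μ-pos : ∀ {i} → i ∈ one-to n → 1 ≤ μ i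
  μ-pos i∈ = proj₂ wf _ (proj₁ (∈-one-to⁻ i∈)) (proj₂ (∈-one-to⁻ i∈))

  6μ≡3+ : ∀ {i} → i ∈ one-to n → ∃ λ K → 6 * μ i ≡ 3 + K
  6μ≡3+ {i} i∈ with μ i | μ-pos i∈
  ... | suc x | _ = 3 + 6 * x , ℕ.*-suc 6 x

  nxt∈ : ∀ {i} → i ∈ one-to n → nxt i ∈ one-to n
  nxt∈ {i} i∈ with i ≡ᵇ n in i≡ᵇn
  ... | true = ∈-one-to⁺ (s≤s z≤n) (ℕ.≤-trans (proj₁ (∈-one-to⁻ i∈)) (ℕ.≤-reflexive (ℕ.≡ᵇ⇒≡ i n (subst T (sym i≡ᵇn) tt))))
  ... | false = ∈-one-to⁺ (s≤s z≤n) (ℕ.≤∧≢⇒< (proj₂ (∈-one-to⁻ i∈)) (λ i≡n → subst T i≡ᵇn (ℕ.≡⇒≡ᵇ i n i≡n)))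

  cPair : ℕ → List Vtx
  cPair j = vc¹ j ∷ vc² j ∷ []

  tzfTriple : ℕ → ℕ → List Vtx
  tzfTriple i ℓ = vt i ℓ ∷ vz i ℓ ∷ vf i ℓ ∷ []

  tzfBlock : ℕ → List Vtx
  tzfBlock i = concatMap (tzfTriple i) (one-to (6 * μ i))

  abPair : ℕ → Lit → List Vtx
  abPair j l = va (proj₁ l) j ∷ vb (proj₁ l) j ∷ []

  abBlock : ℕ × Clause → List Vtx
  abBlock (j , C) = concatMap (abPair j) C

  Vc Vtzf Vab : List Vtx
  Vc = concatMap cPair (one-to m)
  Vtzf = concatMap tzfBlock (one-to n)
  Vab = concatMap abBlock (indexed rem)

  c¹∈V : ∀ {j} → j ∈ one-to m → vc¹ j ∈ V
  c¹∈V j∈ = there (∈-++⁺ˡ (∈-concatMap⁺∃ cPair j∈ (here refl)))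

  c²∈V : ∀ {j} → j ∈ one-to m → vc² j ∈ V
  c²∈V j∈ = there (∈-++⁺ˡ (∈-concatMap⁺∃ cPair j∈ (there (here refl))))

  tzf∈V : ∀ {i ℓ v} → i ∈ one-to n → ℓ ∈ one-to (6 * μ i) → v ∈ vt i ℓ ∷ vz i ℓ ∷ vf i ℓ ∷ [] → v ∈ V
  tzf∈V i∈ ℓ∈ v∈ = there (∈-++⁺ʳ Vc (∈-++⁺ˡ
    (∈-concatMap⁺∃ tzfBlock i∈ (∈-concatMap⁺∃ (tzfTriple _) ℓ∈ v∈))))

  ab∈V : ∀ {j C l v} → (j , C) ∈ indexed rem → l ∈ C → v ∈ va (proj₁ l) j ∷ vb (proj₁ l) j ∷ [] → v ∈ V
  ab∈V jC∈ l∈ v∈ = there (∈-++⁺ʳ Vc (∈-++⁺ʳ Vtzf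
    (∈-concatMap⁺∃ abBlock jC∈ (∈-concatMap⁺∃ (abPair _) l∈ v∈))))

  data VertexKind : Vtx → Set where
    at-c* : VertexKind vc*
    at-c¹ : ∀ {j} → j ∈ one-to m → VertexKind (vc¹ j)
    at-c² : ∀ {j} → j ∈ one-to m → VertexKind (vc² j)
    at-t : ∀ {i ℓ} → i ∈ one-to n → ℓ ∈ one-to (6 * μ i) → VertexKind (vt i ℓ)
    at-z : ∀ {i ℓ} → VertexKind (vz i ℓ)
    at-f : ∀ {i ℓ} → i ∈ one-to n → ℓ ∈ one-to (6 * μ i) → VertexKind (vf i ℓ)
    at-a : ∀ {i j} → VertexKind (va i j)
    at-b : ∀ {i j} → VertexKind (vb i j)

  kind : ∀ {v} → v ∈ V → VertexKind v
  kind (here refl) = at-c*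
  kind (there v∈) with ∈-++⁻ Vc {Vtzf ++ Vab} v∈
  ... | inj₁ v∈Vc with ∈-concatMap⁻∃ cPair {one-to m} v∈Vc
  ...   | j , j∈ , here refl = at-c¹ j∈
  ...   | j , j∈ , there (here refl) = at-c² j∈
  kind (there v∈) | inj₂ v∈′ with ∈-++⁻ Vtzf {Vab} v∈′
  ... | inj₁ v∈Vtzf with ∈-concatMap⁻∃ tzfBlock {one-to n} v∈Vtzf
  ...   | i , i∈ , v∈i with ∈-concatMap⁻∃ (tzfTriple i) {one-to (6 * μ i)} v∈i
  ...     | ℓ , ℓ∈ , here refl = at-t i∈ ℓ∈
  ...     | ℓ , ℓ∈ , there (here refl) = at-z
  ...     | ℓ , ℓ∈ , there (there (here refl)) = at-f i∈ ℓ∈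
  kind (there v∈) | inj₂ v∈′ | inj₂ v∈Vab
    with ∈-concatMap⁻∃ abBlock {indexed rem} v∈Vab
  ... | (j , C) , _ , v∈j with ∈-concatMap⁻∃ (abPair j) {C} v∈j
  ...   | (_ , _) , _ , here refl = at-a
  ...   | (_ , _) , _ , there (here refl) = at-b

  vertexGroup : Vtx → ℕ
  vertexGroup (vc¹ _) = 0
  vertexGroup (vc² _) = 0
  vertexGroup (vt _ _) = 1
  vertexGroup (vz _ _) = 1
  vertexGroup (vf _ _) = 1
  vertexGroup (va _ _) = 2
  vertexGroup (vb _ _) = 2
  vertexGroup vc* = 3

  private
    Vc-group : All (λ v → vertexGroup v ≡ 0) Vc
    Vc-group = All-concatMap⁺ cPair {one-to m} (All.tabulate (λ _ → refl ∷ refl ∷ []))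

    Vtzf-group : All (λ v → vertexGroup v ≡ 1) Vtzf
    Vtzf-group = All-concatMap⁺ tzfBlock {one-to n} (All.tabulate (λ {i} _ → All-concatMap⁺ (tzfTriple i) {one-to (6 * μ i)} (All.tabulate (λ _ → refl ∷ refl ∷ refl ∷ []))))

    Vab-group : All (λ v → vertexGroup v ≡ 2) Vab
    Vab-group = All-concatMap⁺ abBlock {indexed rem} (All.tabulate (λ {jC} _ → All-concatMap⁺ (abPair (proj₁ jC)) {proj₂ jC} (All.tabulate (λ _ → refl ∷ refl ∷ []))))

    Vc-distinct : AllPairs _≢_ Vc
    Vc-distinct = ByVertexKey.AllPairs-concatMap⁺ clauseIndex (λ j → j) cPair (one-to-distinct m)
      (All.tabulate (λ _ → refl ∷ refl ∷ [])) (All.tabulate (λ _ → ((λ ()) ∷ []) ∷ [] ∷ []))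

    Vtzf-distinct : AllPairs _≢_ Vtzf
    Vtzf-distinct = ByVertexKey.AllPairs-concatMap⁺ variableIndex (λ i → i) tzfBlock (one-to-distinct n)
      (All.tabulate (λ {i} _ → All-concatMap⁺ (tzfTriple i) {one-to (6 * μ i)} (All.tabulate (λ _ → refl ∷ refl ∷ refl ∷ []))))
      (All.tabulate (λ {i} _ → ByVertexKey.AllPairs-concatMap⁺ position (λ ℓ → ℓ) (tzfTriple i) (one-to-distinct (6 * μ i))
         (All.tabulate (λ _ → refl ∷ refl ∷ refl ∷ [])) (All.tabulate (λ _ → ((λ ()) ∷ (λ ()) ∷ []) ∷ ((λ ()) ∷ []) ∷ [] ∷ []))))

    Vab-distinct : AllPairs _≢_ Vab
    Vab-distinct = ByVertexKey.AllPairs-concatMap⁺ clauseIndex proj₁ abBlock (indexed-distinct rem)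
      (All.tabulate (λ {jC} _ → All-concatMap⁺ (abPair (proj₁ jC)) {proj₂ jC} (All.tabulate (λ _ → refl ∷ refl ∷ []))))
      (All.tabulate (λ {jC} jC∈ → ByVertexKey.AllPairs-concatMap⁺ variableIndex proj₁ (abPair (proj₁ jC))
         (clause-variables-distinct (∈-indexed-rem⇒∈rem jC∈)) (All.tabulate (λ _ → refl ∷ refl ∷ [])) (All.tabulate (λ _ → ((λ ()) ∷ []) ∷ [] ∷ []))))

  V-distinct : AllPairs _≢_ V
  V-distinct = All.tabulate (λ v∈ c*≡v → c*∉ (subst (_∈ Vc ++ Vtzf ++ Vab) (sym c*≡v) v∈))
             ∷ ByVertexKey.AllPairs-++⁺ (λ v → vertexGroup v ≡ᵇ 0) (λ ()) (All.map (cong (_≡ᵇ 0)) Vc-group)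
                 (All.++⁺ (All.map (cong (_≡ᵇ 0)) Vtzf-group) (All.map (cong (_≡ᵇ 0)) Vab-group)) Vc-distinct
                 (ByVertexKey.AllPairs-++⁺ vertexGroup (λ ()) Vtzf-group Vab-group Vtzf-distinct Vab-distinct)
    where
    c*∉ : vc* ∈ Vc ++ Vtzf ++ Vab → ⊥
    c*∉ c*∈ with All.lookup (All.++⁺ (All.map (cong (_≡ᵇ 3)) Vc-group)
                   (All.++⁺ (All.map (cong (_≡ᵇ 3)) Vtzf-group) (All.map (cong (_≡ᵇ 3)) Vab-group))) c*∈
    ... | ()

  XYall Zall : List Edge
  XYall = concatMap (λ i → Xedges i ++ Yedges i) (one-to n)
  Zall = concatMap (λ jC → concatMap (Zedges (proj₁ jC)) (proj₂ jC)) (indexed rem)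

  Xedges++Yedges≡XYcycles : ∀ {i} → i ∈ one-to n →
    ∃ λ K → (6 * μ i ≡ 3 + K) × (Xedges i ++ Yedges i ≡ XYcycles i (nxt i) (3 + K))
  Xedges++Yedges≡XYcycles {i} i∈ with 6μ≡3+ i∈
  ... | K , 6μ≡ = K , 6μ≡ ,
    subst (λ L → Xedges i ++ Yedges i ≡ XYcycles i (nxt i) L) 6μ≡ (cong (_++ Yedges i) (Xcycle≡Xlisted i (6 * μ i)))

  All-XY : ∀ {i} → i ∈ one-to n → (P : Edge → Set) →
    (∀ K → 6 * μ i ≡ 3 + K → All P (XYcycles i (nxt i) (3 + K))) → All P (Xedges i ++ Yedges i)
  All-XY i∈ P P-XY = let (K , 6μ≡ , XY≡) = Xedges++Yedges≡XYcycles i∈ in subst (All P) (sym XY≡) (P-XY K 6μ≡)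

  XY-distinct : AllPairs _≉ᴱ_ XYall
  XY-distinct = ByEdgeKey.AllPairs-concatMap⁺ blockOwner (λ i → i) (λ i → Xedges i ++ Yedges i) (one-to-distinct n)
    (All.tabulate (λ {i} i∈ → All-XY i∈ (HasKey blockOwner i) (λ K _ → XYcycles-owner i (nxt i) K)))
    (All.tabulate (λ {i} i∈ → let (K , _ , XY≡) = Xedges++Yedges≡XYcycles i∈ in
                                subst (AllPairs _≉ᴱ_) (sym XY≡) (XYcycles-distinct i (nxt i) K)))

  XY-layer : All (HasKey edgeLayer 0) XYall
  XY-layer = All-concatMap⁺ (λ i → Xedges i ++ Yedges i) {one-to n}
    (All.tabulate (λ {i} i∈ → All-XY i∈ (HasKey edgeLayer 0) (λ K _ → XYcycles-layer i (nxt i) (2 + K))))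

  Zedges-keys : ∀ j l → All (ZEdgeKeys (proj₁ l) j) (Zedges j l)
  Zedges-keys j (i , s) = Zcycle-keys s i j (6 * pos i j ∸ 3) (6 * pos i j ∸ 2)

  Z-distinct : AllPairs _≉ᴱ_ Zall
  Z-distinct = ByEdgeKey.AllPairs-concatMap⁺ clauseOf proj₁ (λ jC → concatMap (Zedges (proj₁ jC)) (proj₂ jC)) (indexed-distinct rem)
    (All.tabulate (λ {jC} _ → All-concatMap⁺ (Zedges (proj₁ jC)) {proj₂ jC}
      (All.tabulate (λ {l} _ → All.map (proj₁ ∘ proj₂) (Zedges-keys (proj₁ jC) l)))))
    (All.tabulate (λ {jC} jC∈ → ByEdgeKey.AllPairs-concatMap⁺ variableOf proj₁ (Zedges (proj₁ jC)) (clause-variables-distinct (∈-indexed-rem⇒∈rem jC∈))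
      (All.tabulate (λ {l} _ → All.map (proj₁ ∘ proj₂ ∘ proj₂) (Zedges-keys (proj₁ jC) l)))
      (All.tabulate (λ {l} _ → Zedges-distinct (proj₁ jC) l))))
    where
    Zedges-distinct : ∀ j l → AllPairs _≉ᴱ_ (Zedges j l)
    Zedges-distinct j (i , s) = Zcycle-distinct s i j _ _ (6[1+x]∸3≢6[1+x]∸2 (pos i j ∸ 1))

  Z-layer : All (HasKey edgeLayer 1) Zall
  Z-layer = All-concatMap⁺ (λ jC → concatMap (Zedges (proj₁ jC)) (proj₂ jC)) {indexed rem}
    (All.tabulate (λ {jC} _ → All-concatMap⁺ (Zedges (proj₁ jC)) {proj₂ jC}
      (All.tabulate (λ {l} _ → All.map proj₁ (Zedges-keys (proj₁ jC) l)))))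

  P-distinct : AllPairs _≉ᴱ_ EP
  P-distinct = ByEdgeKey.AllPairs-concatMap⁺ pathVariable (λ i → i) (λ i → concatMap (Pedges i) (one-to (6 * μ i))) (one-to-distinct n)
    (All.tabulate (λ {i} _ → All-concatMap⁺ (Pedges i) {one-to (6 * μ i)} (All.tabulate (λ {ℓ} _ → All.map (proj₁ ∘ proj₂) (Ppath-keys i ℓ)))))
    (All.tabulate (λ {i} _ → ByEdgeKey.AllPairs-concatMap⁺ pathIndex (λ ℓ → ℓ) (Pedges i) (one-to-distinct (6 * μ i))
      (All.tabulate (λ {ℓ} _ → All.map (proj₁ ∘ proj₂ ∘ proj₂) (Ppath-keys i ℓ))) (All.tabulate (λ {ℓ} _ → Ppath-distinct i ℓ))))

  P-layer : All (HasKey edgeLayer 2) EP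
  P-layer = All-concatMap⁺ (λ i → concatMap (Pedges i) (one-to (6 * μ i))) {one-to n}
    (All.tabulate (λ {i} _ → All-concatMap⁺ (Pedges i) {one-to (6 * μ i)} (All.tabulate (λ {ℓ} _ → All.map proj₁ (Ppath-keys i ℓ)))))

  E*-distinct : AllPairs _≉ᴱ_ E*
  E*-distinct = ByEdgeKey.AllPairs-concatMap⁺ starClause (λ j → j) starPair (one-to-distinct m)
    (All.tabulate (λ {j} _ → All.map (proj₁ ∘ proj₂) (starPair-keys j))) (All.tabulate (λ {j} _ → starPair-distinct j))

  E*-layer : All (HasKey edgeLayer 3) E*
  E*-layer = All-concatMap⁺ starPair {one-to m} (All.tabulate (λ {j} _ → All.map proj₁ (starPair-keys j)))

  E-distinct : AllPairs _≉ᴱ_ E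
  E-distinct = ByEdgeKey.AllPairs-++⁺ (inE₀Layer ∘ edgeLayer) (λ ())
      (All.++⁺ (All.map (λ {e} → on-layer 0 {e}) XY-layer) (All.map (λ {e} → on-layer 1 {e}) Z-layer))
      (All.++⁺ (All.map (λ {e} → on-layer 2 {e}) P-layer) (All.map (λ {e} → on-layer 3 {e}) E*-layer))
      (ByEdgeKey.AllPairs-++⁺ edgeLayer (λ ()) XY-layer Z-layer XY-distinct Z-distinct)
      (ByEdgeKey.AllPairs-++⁺ edgeLayer (λ ()) P-layer E*-layer P-distinct E*-distinct)
    where
    on-layer : ∀ k {e} → HasKey edgeLayer k e → HasKey (inE₀Layer ∘ edgeLayer) (inE₀Layer k) e
    on-layer k (p , q) = cong inE₀Layer p , cong inE₀Layer q

  ProperEdge : Edge → Set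
  ProperEdge e = (proj₁ e ≢ proj₂ e) × (proj₁ e ∈ V) × (proj₂ e ∈ V) × NotC–C e

  private
    first-position : ∀ {i} → i ∈ one-to n → 1 ∈ one-to (6 * μ i)
    first-position {i} i∈ = ∈-one-to⁺ (s≤s z≤n) (ℕ.≤-trans (μ-pos i∈) (ℕ.m≤n*m (μ i) 6))

    InXYBlock⇒∈V : ∀ {i K v} → i ∈ one-to n → 6 * μ i ≡ 3 + K → InXYBlock i (nxt i) (3 + K) v → v ∈ V
    InXYBlock⇒∈V i∈ 6μ≡ (inj₁ (ℓ , 1≤ℓ , ℓ≤ , inj₁ refl)) = tzf∈V i∈ (∈-one-to⁺ 1≤ℓ (subst (ℓ ≤_) (sym 6μ≡) ℓ≤)) (here refl)
    InXYBlock⇒∈V i∈ 6μ≡ (inj₁ (ℓ , 1≤ℓ , ℓ≤ , inj₂ refl)) = tzf∈V i∈ (∈-one-to⁺ 1≤ℓ (subst (ℓ ≤_) (sym 6μ≡) ℓ≤)) (there (there (here refl)))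
    InXYBlock⇒∈V i∈ _ (inj₂ (inj₁ refl)) = tzf∈V (nxt∈ i∈) (first-position (nxt∈ i∈)) (here refl)
    InXYBlock⇒∈V i∈ _ (inj₂ (inj₂ refl)) = tzf∈V (nxt∈ i∈) (first-position (nxt∈ i∈)) (there (there (here refl)))

    InXYBlock⇒¬C : ∀ {i i′ L v} → InXYBlock i i′ L v → isC v ≡ false
    InXYBlock⇒¬C (inj₁ (_ , _ , _ , inj₁ refl)) = refl
    InXYBlock⇒¬C (inj₁ (_ , _ , _ , inj₂ refl)) = refl
    InXYBlock⇒¬C (inj₂ (inj₁ refl)) = refl
    InXYBlock⇒¬C (inj₂ (inj₂ refl)) = refl

    literalVertex∈V : ∀ s {i ℓ} → i ∈ one-to n → ℓ ∈ one-to (6 * μ i) → literalVertex s i ℓ ∈ V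
    literalVertex∈V true i∈ ℓ∈ = tzf∈V i∈ ℓ∈ (here refl)
    literalVertex∈V false i∈ ℓ∈ = tzf∈V i∈ ℓ∈ (there (there (here refl)))

    Zcycle-proper : ∀ s i j a b → literalVertex s i a ∈ V → literalVertex s i b ∈ V → vc¹ j ∈ V → vc² j ∈ V → va i j ∈ V → vb i j ∈ V →
                    All ProperEdge (Zcycle s i j a b)
    Zcycle-proper true i j a b ua ub c1 c2 av bv =
      ((λ ()) , ua , c1 , refl) ∷ ((λ ()) , c1 , av , refl) ∷ ((λ ()) , av , c2 , refl) ∷
      ((λ ()) , c2 , ub , refl) ∷ ((λ ()) , ub , bv , refl) ∷ ((λ ()) , bv , ua , refl) ∷ []
    Zcycle-proper false i j a b ua ub c1 c2 av bv =
      ((λ ()) , ua , c1 , refl) ∷ ((λ ()) , c1 , av , refl) ∷ ((λ ()) , av , c2 , refl) ∷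
      ((λ ()) , c2 , ub , refl) ∷ ((λ ()) , ub , bv , refl) ∷ ((λ ()) , bv , ua , refl) ∷ []

    Zedges-proper : ∀ {j C l} → (j , C) ∈ indexed rem → l ∈ C → All ProperEdge (Zedges j l)
    Zedges-proper {j} {C} {i , s} jC∈ l∈ =
      Zcycle-proper s i j _ _ (literalVertex∈V s i∈ (6ℓ∸k∈one-to-6μ 3 (s≤s (s≤s (s≤s (s≤s z≤n)))) (s≤s z≤n) (pos≤μ jC∈ l∈)))
        (literalVertex∈V s i∈ (6ℓ∸k∈one-to-6μ 2 (s≤s (s≤s (s≤s z≤n))) (s≤s z≤n) (pos≤μ jC∈ l∈)))
        (c¹∈V j∈) (c²∈V j∈) (ab∈V jC∈ l∈ (here refl)) (ab∈V jC∈ l∈ (there (here refl)))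
      where
      i∈ : i ∈ one-to n
      i∈ = let (1≤i , i≤n) = literal-in-range (∈-indexed-rem⇒∈rem jC∈) l∈ in ∈-one-to⁺ 1≤i i≤n
      j∈ : j ∈ one-to m
      j∈ = ∈-indexed-rem⇒∈one-to-m jC∈

  E-proper : All ProperEdge E
  E-proper = All.++⁺ (All.++⁺ XY-proper Z-proper) (All.++⁺ P-proper E*-proper)
    where
    XY-proper : All ProperEdge XYall
    XY-proper = All-concatMap⁺ (λ i → Xedges i ++ Yedges i) {one-to n} (All.tabulate (λ {i} i∈ → All-XY i∈ ProperEdge (λ K 6μ≡ →
      All.map (λ {e} (u≢v , u∈ , v∈) → u≢v , InXYBlock⇒∈V i∈ 6μ≡ u∈ , InXYBlock⇒∈V i∈ 6μ≡ v∈ ,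
                                         subst (λ b → (b ∧ isC (proj₂ e)) ≡ false) (sym (InXYBlock⇒¬C u∈)) refl)
        (XYcycles-shape i (nxt i) K))))
    Z-proper : All ProperEdge Zall
    Z-proper = All-concatMap⁺ (λ jC → concatMap (Zedges (proj₁ jC)) (proj₂ jC)) {indexed rem}
      (All.tabulate (λ {jC} jC∈ → All-concatMap⁺ (Zedges (proj₁ jC)) {proj₂ jC} (All.tabulate (λ {l} l∈ → Zedges-proper jC∈ l∈))))
    P-proper : All ProperEdge EP
    P-proper = All-concatMap⁺ (λ i → concatMap (Pedges i) (one-to (6 * μ i))) {one-to n}
      (All.tabulate (λ {i} i∈ → All-concatMap⁺ (Pedges i) {one-to (6 * μ i)} (All.tabulate (λ {ℓ} ℓ∈ →
        ((λ ()) , tzf∈V i∈ ℓ∈ (here refl) , tzf∈V i∈ ℓ∈ (there (here refl)) , refl) ∷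
        ((λ ()) , tzf∈V i∈ ℓ∈ (there (here refl)) , tzf∈V i∈ ℓ∈ (there (there (here refl))) , refl) ∷ []))))
    E*-proper : All ProperEdge E*
    E*-proper = All-concatMap⁺ starPair {one-to m} (All.tabulate (λ {j} j∈ →
      ((λ ()) , c¹∈V j∈ , here refl , refl) ∷ ((λ ()) , here refl , c²∈V j∈ , refl) ∷ []))

  OddDegree EvenDegree : Vtx → Set
  OddDegree v = (deg v % 2 ≡ᵇ 1) ≡ true
  EvenDegree v = (deg v % 2 ≡ᵇ 1) ≡ false

  degree-split : ∀ v → deg v ≡ degreeIn E₀ v + (degreeIn EP v + degreeIn E* v)
  degree-split v = trans (∑-++ E₀ (EP ++ E*) (endpointCount v)) (cong (degreeIn E₀ v +_) (∑-++ EP E* (endpointCount v)))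

  E₀-even : ∀ v → 2 ∣ degreeIn E₀ v
  E₀-even v = subst (2 ∣_) (sym (∑-++ XYall Zall (endpointCount v))) (∣m∣n⇒∣m+n
      (subst (2 ∣_) (sym (∑-concatMap (λ i → Xedges i ++ Yedges i) (one-to n) (endpointCount v)))
        (2∣∑ {xs = one-to n} (All.tabulate (λ {i} _ → subst (2 ∣_) (sym (∑-++ (Xedges i) (Yedges i) (endpointCount v)))
          (∣m∣n⇒∣m+n (X-even i (6 * μ i)) (closed-path-even-degree v (vt i (6 * μ i)) (vf (nxt i) 1 ∷ vf i (6 * μ i) ∷ vt (nxt i) 1 ∷ vt i (6 * μ i) ∷ []) refl))))))
      (subst (2 ∣_) (sym (∑-concatMap (λ jC → concatMap (Zedges (proj₁ jC)) (proj₂ jC)) (indexed rem) (endpointCount v)))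
        (2∣∑ {xs = indexed rem} (All.tabulate (λ {jC} _ → subst (2 ∣_) (sym (∑-concatMap (Zedges (proj₁ jC)) (proj₂ jC) (endpointCount v)))
          (2∣∑ {xs = proj₂ jC} (All.tabulate (λ {l} _ → Z-even (proj₁ jC) l))))))))
    where
    X-even : ∀ i L → 2 ∣ degreeIn (Xcycle i L) v
    X-even i zero = divides 0 refl
    X-even i (suc K) = subst (λ l → 2 ∣ degreeIn (pathEdges l) v) (sym unfold) (closed-path-even-degree v (vt i 1) rest closes)
      where
      rest = map (vt i ∘ suc) (one-to K) ++ map (vf i) (reverse (one-to (suc K))) ++ vt i 1 ∷ []
      unfold : map (vt i) (one-to (suc K)) ++ map (vf i) (reverse (one-to (suc K))) ++ vt i 1 ∷ [] ≡ vt i 1 ∷ rest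
      unfold = cong (_++ (map (vf i) (reverse (one-to (suc K))) ++ vt i 1 ∷ [])) (map-one-to-suc (vt i) K)
      closes : lastOf (vt i 1) rest ≡ vt i 1
      closes = trans (lastOf-++ (vt i 1) (map (vt i ∘ suc) (one-to K)) _) (lastOf-++ _ (map (vf i) (reverse (one-to (suc K)))) (vt i 1 ∷ []))
    Z-even : ∀ j l → 2 ∣ degreeIn (Zedges j l) v
    Z-even j (i , s) = closed-path-even-degree v (u (6 * pos i j ∸ 3)) (vc¹ j ∷ va i j ∷ vc² j ∷ u (6 * pos i j ∸ 2) ∷ vb i j ∷ u (6 * pos i j ∸ 3) ∷ []) refl
      where u = literalVertex s i

  P-degree : ∀ v → degreeIn EP v ≡ ∑ (one-to n) (λ i → ∑ (one-to (6 * μ i)) (λ ℓ → degreeIn (Pedges i ℓ) v))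
  P-degree v = trans (∑-concatMap (λ i → concatMap (Pedges i) (one-to (6 * μ i))) (one-to n) (endpointCount v))
    (∑-cong (one-to n) (λ i → ∑-concatMap (Pedges i) (one-to (6 * μ i)) (endpointCount v)))

  E*-degree : ∀ v → degreeIn E* v ≡ ∑ (one-to m) (λ j → degreeIn (starPair j) v)
  E*-degree v = ∑-concatMap starPair (one-to m) (endpointCount v)

  P-degree-literal : ∀ s {a p} → a ∈ one-to n → p ∈ one-to (6 * μ a) → degreeIn EP (literalVertex s a p) ≡ 1
  P-degree-literal s {a} {p} a∈ p∈ = begin
      degreeIn EP (u a p)
        ≡⟨ P-degree (u a p) ⟩
      ∑ (one-to n) (λ i → ∑ (one-to (6 * μ i)) (λ ℓ → degreeIn (Pedges i ℓ) (u a p)))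
        ≡⟨ ∑-single _ (one-to-distinct n) a∈ (λ i i≢a → ∑-zero {xs = one-to (6 * μ i)} (All.tabulate (λ {ℓ} _ → elsewhere s i ℓ (i≢a ∘ cong proj₁)))) ⟩
      ∑ (one-to (6 * μ a)) (λ ℓ → degreeIn (Pedges a ℓ) (u a p))
        ≡⟨ ∑-single _ (one-to-distinct (6 * μ a)) p∈ (λ ℓ ℓ≢p → elsewhere s a ℓ (ℓ≢p ∘ cong proj₂)) ⟩
      degreeIn (Pedges a p) (u a p)
        ≡⟨ own s ⟩
      1 ∎
    where
    open ≡-Reasoning
    u = literalVertex s
    elsewhere : ∀ s′ i ℓ → (i , ℓ) ≢ (a , p) → degreeIn (Pedges i ℓ) (literalVertex s′ a p) ≡ 0
    elsewhere true i ℓ ne rewrite ≢⇒==V-false (vt a p) (vt i ℓ) (λ e → ne (sym (cong (λ v → variableIndex v , position v) e))) = refl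
    elsewhere false i ℓ ne rewrite ≢⇒==V-false (vf a p) (vf i ℓ) (λ e → ne (sym (cong (λ v → variableIndex v , position v) e))) = refl
    own : ∀ s′ → degreeIn (Pedges a p) (literalVertex s′ a p) ≡ 1
    own true rewrite ==V-refl (vt a p) = refl
    own false rewrite ==V-refl (vf a p) = refl

  E*-degree-c : ∀ {a} → a ∈ one-to m → (degreeIn E* (vc¹ a) ≡ 1) × (degreeIn E* (vc² a) ≡ 1)
  E*-degree-c {a} a∈ =
      trans (E*-degree (vc¹ a)) (trans (∑-single (λ j → degreeIn (starPair j) (vc¹ a)) (one-to-distinct m) a∈ elsewhere¹) own¹)
    , trans (E*-degree (vc² a)) (trans (∑-single (λ j → degreeIn (starPair j) (vc² a)) (one-to-distinct m) a∈ elsewhere²) own²)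
    where
    elsewhere¹ : ∀ j → j ≢ a → degreeIn (starPair j) (vc¹ a) ≡ 0
    elsewhere¹ j j≢a rewrite ≢⇒==V-false (vc¹ a) (vc¹ j) (λ e → j≢a (sym (cong clauseIndex e))) = refl
    elsewhere² : ∀ j → j ≢ a → degreeIn (starPair j) (vc² a) ≡ 0
    elsewhere² j j≢a rewrite ≢⇒==V-false (vc² a) (vc² j) (λ e → j≢a (sym (cong clauseIndex e))) = refl
    own¹ : degreeIn (starPair a) (vc¹ a) ≡ 1
    own¹ rewrite ==V-refl (vc¹ a) = refl
    own² : degreeIn (starPair a) (vc² a) ≡ 1
    own² rewrite ==V-refl (vc² a) = refl

  P-degree-vanishes : ∀ v → (∀ i ℓ → degreeIn (Pedges i ℓ) v ≡ 0) → degreeIn EP v ≡ 0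
  P-degree-vanishes v vanishes = trans (P-degree v)
    (∑-zero {xs = one-to n} (All.tabulate (λ {i} _ → ∑-zero {xs = one-to (6 * μ i)} (All.tabulate (λ {ℓ} _ → vanishes i ℓ)))))

  E*-degree-vanishes : ∀ v → (∀ j → degreeIn (starPair j) v ≡ 0) → degreeIn E* v ≡ 0
  E*-degree-vanishes v vanishes = trans (E*-degree v) (∑-zero {xs = one-to m} (All.tabulate (λ {j} _ → vanishes j)))

  odd-degree : ∀ v → degreeIn EP v + degreeIn E* v ≡ 1 → OddDegree v
  odd-degree v outside-E₀ =
    trans (cong (λ x → x % 2 ≡ᵇ 1) (trans (degree-split v) (cong (degreeIn E₀ v +_) outside-E₀))) (even+1-odd (E₀-even v))

  even-degree : ∀ v → 2 ∣ degreeIn EP v + degreeIn E* v → EvenDegree v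
  even-degree v outside-E₀ = trans (cong (λ x → x % 2 ≡ᵇ 1) (degree-split v)) (even-not-odd (∣m∣n⇒∣m+n (E₀-even v) outside-E₀))

  z-even : ∀ a p → EvenDegree (vz a p)
  z-even a p = even-degree (vz a p) (subst (2 ∣_) (sym (cong₂ _+_ (P-degree (vz a p)) (E*-degree-vanishes (vz a p) (λ _ → refl))))
    (∣m∣n⇒∣m+n (2∣∑ {xs = one-to n} (All.tabulate (λ {i} _ → 2∣∑ {xs = one-to (6 * μ i)} (All.tabulate (λ {ℓ} _ → twice (χ (vz a p ==V vz i ℓ)))))))
               (divides 0 refl)))
    where
    two-ends : ∀ x → (0 + x) + ((x + 0) + 0) ≡ x * 2
    two-ends = solve-∀
    twice : ∀ x → 2 ∣ (0 + x) + ((x + 0) + 0)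
    twice x = divides x (two-ends x)

  c*-even : EvenDegree vc*
  c*-even = even-degree vc* (subst (2 ∣_) (sym (cong₂ _+_ (P-degree-vanishes vc* (λ _ _ → refl)) (E*-degree vc*)))
    (2∣∑ {xs = one-to m} (All.tabulate (λ _ → divides 1 refl))))

  even-if-only-in-E₀ : ∀ v → (∀ i ℓ → degreeIn (Pedges i ℓ) v ≡ 0) → (∀ j → degreeIn (starPair j) v ≡ 0) → EvenDegree v
  even-if-only-in-E₀ v P-zero E*-zero =
    even-degree v (subst (2 ∣_) (sym (cong₂ _+_ (P-degree-vanishes v P-zero) (E*-degree-vanishes v E*-zero))) (divides 0 refl))

  c¹∈C : ∀ {j} → j ∈ one-to m → V-C (vc¹ j)
  c¹∈C {j} j∈ = j , proj₁ (∈-one-to⁻ j∈) , proj₂ (∈-one-to⁻ j∈) , inj₁ refl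

  c²∈C : ∀ {j} → j ∈ one-to m → V-C (vc² j)
  c²∈C {j} j∈ = j , proj₁ (∈-one-to⁻ j∈) , proj₂ (∈-one-to⁻ j∈) , inj₂ refl

  odd⇒FT∪C : ∀ {v} → v ∈ V → OddDegree v → V-FT v ⊎ V-C v
  odd⇒FT∪C v∈ = by-kind (kind v∈)
    where
    in-FT : ∀ {i ℓ v} → i ∈ one-to n → ℓ ∈ one-to (6 * μ i) → (v ≡ vt i ℓ) ⊎ (v ≡ vf i ℓ) → V-FT v
    in-FT {i} {ℓ} i∈ ℓ∈ v≡ = i , ℓ , proj₁ (∈-one-to⁻ i∈) , proj₂ (∈-one-to⁻ i∈) , proj₁ (∈-one-to⁻ ℓ∈) , proj₂ (∈-one-to⁻ ℓ∈) , v≡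
    by-kind : ∀ {v} → VertexKind v → OddDegree v → V-FT v ⊎ V-C v
    by-kind at-c* odd = ⊥-elim (true≢false odd c*-even)
    by-kind (at-c¹ j∈) _ = inj₂ (c¹∈C j∈)
    by-kind (at-c² j∈) _ = inj₂ (c²∈C j∈)
    by-kind (at-t i∈ ℓ∈) _ = inj₁ (in-FT i∈ ℓ∈ (inj₁ refl))
    by-kind (at-z {i} {ℓ}) odd = ⊥-elim (true≢false odd (z-even i ℓ))
    by-kind (at-f i∈ ℓ∈) _ = inj₁ (in-FT i∈ ℓ∈ (inj₂ refl))
    by-kind (at-a {i} {j}) odd = ⊥-elim (true≢false odd (even-if-only-in-E₀ (va i j) (λ _ _ → refl) (λ _ → refl)))
    by-kind (at-b {i} {j}) odd = ⊥-elim (true≢false odd (even-if-only-in-E₀ (vb i j) (λ _ _ → refl) (λ _ → refl)))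

  FT∪C⇒odd : ∀ {v} → V-FT v ⊎ V-C v → (v ∈ V) × OddDegree v
  FT∪C⇒odd (inj₁ (i , ℓ , 1≤i , i≤n , 1≤ℓ , ℓ≤ , inj₁ refl)) = let i∈ = ∈-one-to⁺ 1≤i i≤n ; ℓ∈ = ∈-one-to⁺ 1≤ℓ ℓ≤ in
    tzf∈V i∈ ℓ∈ (here refl) , odd-degree (vt i ℓ) (cong₂ _+_ (P-degree-literal true i∈ ℓ∈) (E*-degree-vanishes (vt i ℓ) (λ _ → refl)))
  FT∪C⇒odd (inj₁ (i , ℓ , 1≤i , i≤n , 1≤ℓ , ℓ≤ , inj₂ refl)) = let i∈ = ∈-one-to⁺ 1≤i i≤n ; ℓ∈ = ∈-one-to⁺ 1≤ℓ ℓ≤ in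
    tzf∈V i∈ ℓ∈ (there (there (here refl))) , odd-degree (vf i ℓ) (cong₂ _+_ (P-degree-literal false i∈ ℓ∈) (E*-degree-vanishes (vf i ℓ) (λ _ → refl)))
  FT∪C⇒odd (inj₂ (j , 1≤j , j≤m , inj₁ refl)) = let j∈ = ∈-one-to⁺ 1≤j j≤m in
    c¹∈V j∈ , odd-degree (vc¹ j) (cong₂ _+_ (P-degree-vanishes (vc¹ j) (λ _ _ → refl)) (proj₁ (E*-degree-c j∈)))
  FT∪C⇒odd (inj₂ (j , 1≤j , j≤m , inj₂ refl)) = let j∈ = ∈-one-to⁺ 1≤j j≤m in
    c²∈V j∈ , odd-degree (vc² j) (cong₂ _+_ (P-degree-vanishes (vc² j) (λ _ _ → refl)) (proj₂ (E*-degree-c j∈)))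

-- Consequences of tightness

module TightTourProperties (φ : Formula) (wf : WellFormed φ) (T : ClosedWalk) (tight : TightTour φ T) where
  open Construction φ hiding (WellFormed; TightTour; Conclusion-i; Conclusion-ii; Conclusion-iii)
  open Instance φ wf
  open Feasible (proj₁ tight)
  open SurplusCount E V T E-distinct (All.map proj₁ E-proper) V-distinct onEdges covers

  FT∪C : Vtx → Set
  FT∪C v = V-FT v ⊎ V-C v

  surplus≡parity : ∀ {v} → v ∈ V → surplus v ≡ χ (deg v % 2 ≡ᵇ 1)
  surplus≡parity = All.lookup (surplus≡isOdd (proj₂ tight))

  incident-endpoint₁ : ∀ e → incidentᵇ (proj₁ e) e ≡ true
  incident-endpoint₁ e = cong (_∨ (proj₁ e ==V proj₂ e)) (==V-refl (proj₁ e))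

  incident-endpoint₂ : ∀ e → incidentᵇ (proj₂ e) e ≡ true
  incident-endpoint₂ e = trans (cong ((proj₂ e ==V proj₁ e) ∨_) (==V-refl (proj₂ e))) (∨-zeroʳ _)

  excess≤surplus : ∀ {e v} → e ∈ E → incidentᵇ v e ≡ true → excess e ≤ surplus v
  excess≤surplus {e} {v} e∈ inc = subst (_≤ surplus v) (cong (λ b → if b then excess e else 0) inc)
    (term≤∑ (λ e′ → if incidentᵇ v e′ then excess e′ else 0) e∈)

  excess≤1 : ∀ e → e ∈ E → excess e ≤ 1
  excess≤1 e e∈ = ℕ.≤-trans (excess≤surplus {v = proj₁ e} e∈ (incident-endpoint₁ e))
    (subst (_≤ 1) (sym (surplus≡parity (proj₁ (proj₂ (All.lookup E-proper e∈))))) (χ≤1 _))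

  repeated-endpoint-odd : ∀ {e v} → e ∈ E → 1 ≤ excess e → incidentᵇ v e ≡ true → v ∈ V → OddDegree v
  repeated-endpoint-odd {v = v} e∈ 1≤excess inc v∈ =
    χ-pos⁻ (subst (1 ≤_) (surplus≡parity v∈) (ℕ.≤-trans 1≤excess (excess≤surplus {v = v} e∈ inc)))

  repeated-edge-odd-endpoints : ∀ e → InM T e → OddDegree (proj₁ e) × OddDegree (proj₂ e)
  repeated-edge-odd-endpoints e (e∈ , 1≤excess) = let (_ , u∈ , v∈ , _) = All.lookup E-proper e∈ in
    repeated-endpoint-odd e∈ 1≤excess (incident-endpoint₁ e) u∈ , repeated-endpoint-odd e∈ 1≤excess (incident-endpoint₂ e) v∈

  M-endpoints : ∀ e → InM T e → FT∪C (proj₁ e) × FT∪C (proj₂ e)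
  M-endpoints e e∈M = let (_ , u∈ , v∈ , _) = All.lookup E-proper (proj₁ e∈M) ; (u-odd , v-odd) = repeated-edge-odd-endpoints e e∈M in
    odd⇒FT∪C u∈ u-odd , odd⇒FT∪C v∈ v-odd

  FT∪C-surplus≡1 : ∀ v → FT∪C v → surplus v ≡ 1
  FT∪C-surplus≡1 v v∈FT∪C = let (v∈ , odd) = FT∪C⇒odd v∈FT∪C in trans (surplus≡parity v∈) (cong χ odd)

  ∈EP⁻ : ∀ {e} → e ∈ EP → ∃₂ λ i ℓ → (i ∈ one-to n) × (ℓ ∈ one-to (6 * μ i)) × (e ∈ Pedges i ℓ)
  ∈EP⁻ e∈ with ∈-concatMap⁻∃ (λ i → concatMap (Pedges i) (one-to (6 * μ i))) {one-to n} e∈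
  ... | i , i∈ , e∈i with ∈-concatMap⁻∃ (Pedges i) {one-to (6 * μ i)} e∈i
  ...   | ℓ , ℓ∈ , e∈iℓ = i , ℓ , i∈ , ℓ∈ , e∈iℓ

  ∈E*⁻ : ∀ {e} → e ∈ E* → ∃ λ j → (j ∈ one-to m) × (e ∈ starPair j)
  ∈E*⁻ = ∈-concatMap⁻∃ starPair {one-to m}

  M∩EP-empty : ∀ {e} → InM T e → e ∈ EP → ⊥
  M∩EP-empty {e} e∈M e∈EP = excluded (∈EP⁻ e∈EP) (repeated-edge-odd-endpoints e e∈M)
    where
    excluded : (∃₂ λ i ℓ → (i ∈ one-to n) × (ℓ ∈ one-to (6 * μ i)) × (e ∈ Pedges i ℓ)) → OddDegree (proj₁ e) × OddDegree (proj₂ e) → ⊥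
    excluded (i , ℓ , _ , _ , here refl) (_ , v-odd) = true≢false v-odd (z-even i ℓ)
    excluded (i , ℓ , _ , _ , there (here refl)) (u-odd , _) = true≢false u-odd (z-even i ℓ)

  M∩E*-empty : ∀ {e} → InM T e → e ∈ E* → ⊥
  M∩E*-empty {e} e∈M e∈E* = excluded (∈E*⁻ e∈E*) (repeated-edge-odd-endpoints e e∈M)
    where
    excluded : (∃ λ j → (j ∈ one-to m) × (e ∈ starPair j)) → OddDegree (proj₁ e) × OddDegree (proj₂ e) → ⊥
    excluded (_ , _ , here refl) (_ , v-odd) = true≢false v-odd c*-even
    excluded (_ , _ , there (here refl)) (u-odd , _) = true≢false u-odd c*-even

  M⊆E₀ : ∀ e → InM T e → e ∈ E₀
  M⊆E₀ e e∈M = [ (λ e∈E₀ → e∈E₀) , (λ e∈EP++E* → ⊥-elim ([ M∩EP-empty e∈M , M∩E*-empty e∈M ] (∈-++⁻ EP e∈EP++E*))) ]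
    (∈-++⁻ E₀ (proj₁ e∈M))

  conclusion-i : Construction.Conclusion-i φ T
  conclusion-i = M⊆E₀ , M-endpoints , FT∪C-surplus≡1 , excess≤1

  M-meets-FT : ∀ e → InM T e → V-FT (proj₁ e) ⊎ V-FT (proj₂ e)
  M-meets-FT e e∈M = choose (M-endpoints e e∈M) (proj₂ (proj₂ (proj₂ (All.lookup E-proper (proj₁ e∈M)))))
    where
    C⇒isC : ∀ {v} → V-C v → isC v ≡ true
    C⇒isC (_ , _ , _ , inj₁ refl) = refl
    C⇒isC (_ , _ , _ , inj₂ refl) = refl
    choose : FT∪C (proj₁ e) × FT∪C (proj₂ e) → NotC–C e → V-FT (proj₁ e) ⊎ V-FT (proj₂ e)
    choose (inj₁ u∈FT , _) _ = inj₁ u∈FT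
    choose (inj₂ _ , inj₁ v∈FT) _ = inj₂ v∈FT
    choose (inj₂ u∈C , inj₂ v∈C) not-C–C = ⊥-elim (true≢false (cong₂ _∧_ (C⇒isC u∈C) (C⇒isC v∈C)) not-C–C)

  H : Vtx → Vtx → Set
  H = HAdj T

  start : Vtx
  start = vtx T 0

  H-sym : ∀ {u v} → H u v → H v u
  H-sym (e , e∈H , inj₁ p) = e , e∈H , inj₂ p
  H-sym (e , e∈H , inj₂ p) = e , e∈H , inj₁ p

  traversed-twice⇒M : ∀ {e k′ k} → k′ < k → k < len T → Trav T k′ e → Trav T k e → 1 ≤ Mmult T e
  traversed-twice⇒M {e} {k′} {k} k′<k k<L tr′ tr = ℕ.≤-trans (s≤s z≤n) (ℕ.∸-monoˡ-≤ 1 two≤mult)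
    where
    counted : ∀ {j} → Trav T j e → χ (usesᵇ j e) ≡ 1
    counted tr = cong χ (stepOnᵇ-complete _ _ e tr)
    two≤mult : 2 ≤ mult T e
    two≤mult = subst (2 ≤_) (sym (mult≡∑ e)) (subst (_≤ ∑ (upTo L) (λ j → χ (usesᵇ j e))) (cong₂ _+_ (counted tr′) (counted tr))
      (two-terms≤∑ (λ j → χ (usesᵇ j e)) (AllPairs.applyUpTo⁺₁ (λ j → j) L (λ i<j _ → ℕ.<⇒≢ i<j))
        (∈-upTo⁺ (ℕ.<-trans k′<k k<L)) (∈-upTo⁺ k<L) (ℕ.<⇒≢ k′<k)))

  ∈EP⇒class : ∀ {e} → e ∈ EP → ∃₂ λ i ℓ → e ∈C cP i ℓ
  ∈EP⇒class e∈EP = let (i , ℓ , i∈ , ℓ∈ , e∈iℓ) = ∈EP⁻ e∈EP in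
    i , ℓ , proj₁ (∈-one-to⁻ i∈) , proj₂ (∈-one-to⁻ i∈) , proj₁ (∈-one-to⁻ ℓ∈) , proj₂ (∈-one-to⁻ ℓ∈) , e∈iℓ

  module AfterPathStep {s e} (s<L : s < len T) (e∈EP : e ∈ EP) (tr : Trav T s e) where

    -- E₀ precedes every path class, so each later step either repeats an edge of E₀ or leaves E₀.
    step-in-H : ∀ k → s ≤ k → k < len T → H (vtx T k) (vtx T (suc k))
    step-in-H k s≤k k<L = by-edge (onEdges k k<L)
      where
      by-edge : (∃ λ e′ → (e′ ∈ E) × Trav T k e′) → H (vtx T k) (vtx T (suc k))
      by-edge (e′ , e′∈ , tr′) = by-E₀ (e′ ∈? E₀)
        where
        by-E₀ : Dec (e′ ∈ E₀) → H (vtx T k) (vtx T (suc k))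
        by-E₀ (no e′∉E₀) = e′ , inj₁ (e′∈ , e′∉E₀) , tr′
        by-E₀ (yes e′∈E₀) =
          let (i , ℓ , e∈class) = ∈EP⇒class e∈EP
              (k′ , k′<s , tr″) = respects (cP i ℓ) cE₀ E₀≺P s s<L e e∈class tr e′ e′∈E₀
          in e′ , inj₂ (e′∈ , traversed-twice⇒M (ℕ.<-≤-trans k′<s s≤k) k<L tr″ tr′) , tr′

    reaches-end : ∀ d k → k + d ≡ len T → s ≤ k → Star H (vtx T k) (vtx T (len T))
    reaches-end zero k k≡L _ = subst (λ x → Star H (vtx T k) (vtx T x)) (trans (sym (ℕ.+-identityʳ k)) k≡L) ε
    reaches-end (suc d) k k+d≡L s≤k =
      step-in-H k s≤k k<L ◅ reaches-end d (suc k) (trans (sym (ℕ.+-suc k d)) k+d≡L) (ℕ.m≤n⇒m≤1+n s≤k)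
      where
      k<L : k < len T
      k<L = subst (k <_) k+d≡L (ℕ.m<m+n k (s≤s z≤n))

    reaches-start : ∀ k → s ≤ k → k ≤ len T → Star H (vtx T k) start
    reaches-start k s≤k k≤L = subst (Star H (vtx T k)) (closed T) (reaches-end (len T ∸ k) k (ℕ.m+[n∸m]≡n k≤L) s≤k)

    endpoints-reach-start : ∀ {u} → (proj₁ e ≡ u) ⊎ (proj₂ e ≡ u) → Star H u start
    endpoints-reach-start = by-direction tr
      where
      here-or-next : ∀ {u} → (vtx T s ≡ u) ⊎ (vtx T (suc s) ≡ u) → Star H u start
      here-or-next (inj₁ refl) = reaches-start s ℕ.≤-refl (ℕ.<⇒≤ s<L)
      here-or-next (inj₂ refl) = reaches-start (suc s) (ℕ.n≤1+n s) s<L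
      by-direction : ∀ {u} → Trav T s e → (proj₁ e ≡ u) ⊎ (proj₂ e ≡ u) → Star H u start
      by-direction (inj₁ refl) end = here-or-next end
      by-direction (inj₂ refl) end = here-or-next (⊎-swap end)

  path-endpoint-reaches-start : ∀ {e u} → e ∈ EP → (proj₁ e ≡ u) ⊎ (proj₂ e ≡ u) → Star H u start
  path-endpoint-reaches-start {e} e∈EP with covers e (∈-++⁺ʳ E₀ (∈-++⁺ˡ e∈EP))
  ... | s , s<L , tr = AfterPathStep.endpoints-reach-start s<L e∈EP tr

  Pedge∈EP : ∀ {i ℓ e} → 1 ≤ i → i ≤ n → 1 ≤ ℓ → ℓ ≤ 6 * μ i → e ∈ Pedges i ℓ → e ∈ EP
  Pedge∈EP {i} 1≤i i≤n 1≤ℓ ℓ≤ e∈ =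
    ∈-concatMap⁺∃ (λ i → concatMap (Pedges i) (one-to (6 * μ i))) (∈-one-to⁺ 1≤i i≤n) (∈-concatMap⁺∃ (Pedges i) (∈-one-to⁺ 1≤ℓ ℓ≤) e∈)

  FT-reaches-start : ∀ {w} → V-FT w → Star H w start
  FT-reaches-start (i , ℓ , 1≤i , i≤n , 1≤ℓ , ℓ≤ , inj₁ refl) = path-endpoint-reaches-start (Pedge∈EP 1≤i i≤n 1≤ℓ ℓ≤ (here refl)) (inj₁ refl)
  FT-reaches-start (i , ℓ , 1≤i , i≤n , 1≤ℓ , ℓ≤ , inj₂ refl) = path-endpoint-reaches-start (Pedge∈EP 1≤i i≤n 1≤ℓ ℓ≤ (there (here refl))) (inj₂ refl)

  M-endpoints-reach-start : ∀ {e} → InM T e → Star H (proj₁ e) start × Star H (proj₂ e) start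
  M-endpoints-reach-start {e} e∈M = by-FT-end (M-meets-FT e e∈M)
    where
    by-FT-end : V-FT (proj₁ e) ⊎ V-FT (proj₂ e) → Star H (proj₁ e) start × Star H (proj₂ e) start
    by-FT-end (inj₁ u∈FT) = FT-reaches-start u∈FT , (e , inj₂ e∈M , inj₂ refl) ◅ FT-reaches-start u∈FT
    by-FT-end (inj₂ v∈FT) = (e , inj₂ e∈M , inj₁ refl) ◅ FT-reaches-start v∈FT , FT-reaches-start v∈FT

  -- c_j^1 and c_j^2 have surplus 1, so they lie on an edge of M.
  C-reaches-start : ∀ {c} → V-C c → Star H c start
  C-reaches-start {c} c∈C = let (e , e∈ , pos) = positive-term (λ e → if incidentᵇ c e then Mmult T e else 0) 1≤surplus in
    via-M-edge e∈ (incidentᵇ c e) refl pos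
    where
    1≤surplus : 1 ≤ surplus c
    1≤surplus = ℕ.≤-reflexive (sym (FT∪C-surplus≡1 c (inj₂ c∈C)))
    via-M-edge : ∀ {e} → e ∈ E → (b : Bool) → incidentᵇ c e ≡ b → 1 ≤ (if b then Mmult T e else 0) → Star H c start
    via-M-edge {e} e∈ true inc 1≤excess with ∨-true⁻ {c ==V proj₁ e} inc
    ... | inj₁ c≡u = subst (λ x → Star H x start) (sym (==V⇒≡ c _ c≡u)) (proj₁ (M-endpoints-reach-start (e∈ , 1≤excess)))
    ... | inj₂ c≡v = subst (λ x → Star H x start) (sym (==V⇒≡ c _ c≡v)) (proj₂ (M-endpoints-reach-start (e∈ , 1≤excess)))

  star-edge-endpoint-reaches-start : ∀ {e u} → e ∈ E → ¬ (e ∈ E₀) → (proj₁ e ≡ u) ⊎ (proj₂ e ≡ u) →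
    (∃ λ j → (j ∈ one-to m) × (e ∈ starPair j)) → Star H u start
  star-edge-endpoint-reaches-start e∈ e∉E₀ (inj₁ refl) (j , j∈ , here refl) = C-reaches-start (c¹∈C j∈)
  star-edge-endpoint-reaches-start e∈ e∉E₀ (inj₂ refl) (j , j∈ , here refl) = (_ , inj₁ (e∈ , e∉E₀) , inj₂ refl) ◅ C-reaches-start (c¹∈C j∈)
  star-edge-endpoint-reaches-start e∈ e∉E₀ (inj₁ refl) (j , j∈ , there (here refl)) = (_ , inj₁ (e∈ , e∉E₀) , inj₁ refl) ◅ C-reaches-start (c²∈C j∈)
  star-edge-endpoint-reaches-start e∈ e∉E₀ (inj₂ refl) (j , j∈ , there (here refl)) = C-reaches-start (c²∈C j∈)

  H-vertex-reaches-start : ∀ {u} → HVtx T u → Star H u start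
  H-vertex-reaches-start (e , inj₂ e∈M , inj₁ refl) = proj₁ (M-endpoints-reach-start e∈M)
  H-vertex-reaches-start (e , inj₂ e∈M , inj₂ refl) = proj₂ (M-endpoints-reach-start e∈M)
  H-vertex-reaches-start (e , inj₁ (e∈ , e∉E₀) , end) =
    [ (λ e∈E₀ → ⊥-elim (e∉E₀ e∈E₀))
    , (λ e∈EP++E* → [ (λ e∈EP → path-endpoint-reaches-start e∈EP end) , (λ e∈E* → star-edge-endpoint-reaches-start e∈ e∉E₀ end (∈E*⁻ e∈E*)) ]
                      (∈-++⁻ EP e∈EP++E*)) ]
    (∈-++⁻ E₀ e∈)

  conclusion-iii : Construction.Conclusion-iii φ T
  conclusion-iii u v u∈H v∈H = H-vertex-reaches-start u∈H ◅◅ Star.reverse H-sym (H-vertex-reaches-start v∈H)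

lemma1 : (φ : Formula) → WellFormed φ → (T : ClosedWalk) → TightTour φ T →
           Conclusion-i φ T × Conclusion-ii φ T × Conclusion-iii φ T
lemma1 φ wf T tight = conclusion-i , M-meets-FT , conclusion-iii
  where open TightTourProperties φ wf T tight
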